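{- Let $p>3$ be a prime number. The number $|Q_p(3p)|$ of equivalence classes of $p$-circular $3p$-polygons equals $\dfrac{(p-1)^2(p-2)}{3}$.
   Context: Let $n\ge 3$ and $V_n=\{v_k=e^{2\pi i k/n}: k=0,\dots,n-1\}\subset\mathbb{C}$. An $n$-polygon is a closed polygonal path visiting every point of $V_n$ exactly once: for a cyclic ordering $(\sigma_1,\dots,\sigma_n)$ of $\{0,\dots,n-1\}$ it is the union of the segments $[v_{\sigma_i},v_{\sigma_{i+1}}]$, $i=1,\dots,n$, with $\sigma_{n+1}=\sigma_1$. Two $n$-polygons are equivalent if one is obtained from the other by a rotation about $0$ (reflections not allowed). A symmetry axis of an $n$-polygon is a line through $0$ such that reflection in it maps the polygon (as a union of segments) onto itself. For $m>2$ and $n=3m$, an $m$-circular $3m$-polygon is a $3m$-polygon that has no symmetry axis and is mapped onto itself by the rotations about $0$ through the angles $\frac{3\cdot 2\pi i}{n}$, $i=1,\dots,m$. -}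

module Defs where

open import Data.Nat using (ℕ; zero; suc; _+_; _*_; _∸_; _≤_; NonZero)
open import Data.Nat.Properties using (m*n≢0)
open import Data.Nat.DivMod using (_mod_)
open import Data.Fin using (Fin; toℕ)
open import Data.Product using (Σ; ∃; _×_; _,_)
open import Data.Sum using (_⊎_)
open import Data.List using (List; length)
open import Data.List.Relation.Unary.All using (All)
open import Data.List.Relation.Unary.Any using (Any)
open import Data.List.Relation.Unary.AllPairs using (AllPairs)
open import Function using (_⇔_)
open import Function.Definitions using (Injective)
open import Relation.Nullary using (¬_)
open import Relation.Binary.PropositionalEquality using (_≡_)

-- Vertex v_k = e^{2πik/n} is represented by k : Fin n.
-- An n-polygon is given by a cyclic ordering σ (a bijection Fin n → Fin n,
-- injectivity suffices on a finite set); σ i is the i-th visited vertex.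
Polygon : (n : ℕ) → Set
Polygon n = Σ (Fin n → Fin n) (λ σ → Injective _≡_ _≡_ σ)

module _ (n : ℕ) .{{_ : NonZero n}} where

  next : Fin n → Fin n
  next i = (toℕ i + 1) mod n

  Edge : Polygon n → Fin n → Fin n → Set
  Edge (σ , _) a b =
    ∃ λ i → (σ i ≡ a × σ (next i) ≡ b) ⊎ (σ i ≡ b × σ (next i) ≡ a)

  -- rotation about 0 through the angle 2πc/n : v_k ↦ v_{k+c}
  rot : ℕ → Fin n → Fin n
  rot c k = (toℕ k + c) mod n

  -- reflection in the line through 0 and e^{πic/n} : v_k ↦ v_{c-k}
  -- (these are exactly the reflections in lines through 0 preserving V_n)
  refl : ℕ → Fin n → Fin n
  refl c k = (c + (n ∸ toℕ k)) mod n

  -- the map f (a permutation of V_n) maps polygon P onto polygon Q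
  -- (equality of the sets of segments, equivalently of their unions)
  MapsOnto : (Fin n → Fin n) → Polygon n → Polygon n → Set
  MapsOnto f P Q = ∀ a b → Edge P a b ⇔ Edge Q (f a) (f b)

  HasSymmetryAxis : Polygon n → Set
  HasSymmetryAxis P = ∃ λ c → MapsOnto (refl c) P P

  Equivalent : Polygon n → Polygon n → Set
  Equivalent P Q = ∃ λ c → MapsOnto (rot c) P Q

module _ (m : ℕ) .{{_ : NonZero m}} where

  private
    instance
      nz3m : NonZero (3 * m)
      nz3m = m*n≢0 3 m

  Circular : Polygon (3 * m) → Set
  Circular P = ¬ HasSymmetryAxis (3 * m) P
             × (∀ i → 1 ≤ i → i ≤ m → MapsOnto (3 * m) (rot (3 * m) (3 * i)) P P)

  -- |Q_m(3m)| = N : there is a list of N pairwise non-equivalent m-circular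
  -- 3m-polygons such that every m-circular 3m-polygon is equivalent to one of them.
  NumCircularClasses : ℕ → Set
  NumCircularClasses N =
    Σ (List (Polygon (3 * m))) λ L →
        length L ≡ N
      × All Circular L
      × AllPairs (λ P Q → ¬ Equivalent (3 * m) P Q) L
      × (∀ P → Circular P → Any (λ Q → Equivalent (3 * m) P Q) L)

{-# OPTIONS --safe #-}
module Submission where

-- Vertex k of the 3p-gon has class k mod 3, and a p-circular polygon is read as an n-periodic
-- walk.  If two vertices k steps apart on the walk lie in the same class, one is the image of
-- the other under a rotation by 3i, which is a symmetry of the polygon.  Rotating the edges one
-- at a time shows that the walk then repeats this shift everywhere, so that after p rounds
-- p k ≡ 0 (mod 3p), i.e. 3 ∣ k, unless the rotation reverses an edge, which is impossible for
-- odd p.  Hence, after reversing the walk if necessary, the classes run through 0, 1, 2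
-- cyclically and the walk advances by 3i every three steps: the polygon is determined by the
-- steps 3e₀+1, 3e₁+1, 3e₂+1 out of the three classes.  Conversely such steps close up into a
-- polygon iff p ∤ e₀+e₁+e₂+1, it has no symmetry axis iff the eⱼ are distinct, and two of
-- them are equivalent iff the triples are cyclic rotations of each other.  Substituting
-- e₁ = e₀ + g₁ and e₂ = e₀ + g₂ (mod p), there are (p-1)·(p-1)(p-2) valid triples, and every
-- class contains exactly three of them.

open import Level using (0ℓ)
open import Data.Nat
open import Data.Nat.Properties
open import Data.Nat.DivMod
open import Data.Nat.Divisibility using (_∣_; _∣?_; divides; ∣⇒≤; m%n≡0⇒n∣m; n∣m⇒m%n≡0; *-cancelˡ-∣)
open import Data.Nat.Primality using (Prime; euclidsLemma)
open import Data.Nat.Solver using (module +-*-Solver)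
open import Data.Fin using (Fin; toℕ; punchOut)
open import Data.Fin.Properties using (toℕ-injective; toℕ<n; toℕ-fromℕ<; any?; punchOut-injective; injective⇒≤)
open import Data.Product using (Σ; ∃; _×_; _,_; proj₁; proj₂)
open import Data.Sum using (_⊎_; inj₁; inj₂; [_,_]′; map₁)
open import Data.Empty using (⊥; ⊥-elim)
open import Data.List using (List; []; _∷_; length; map)
open import Data.List.Properties using (length-map)
open import Data.List.Relation.Unary.All as All using (All; []; _∷_)
import Data.List.Relation.Unary.All.Properties as Allₚ
open import Data.List.Relation.Unary.Any as Any using (Any; here; there)
import Data.List.Relation.Unary.Any.Properties as Anyₚ
open import Data.List.Relation.Unary.AllPairs as AllPairs using (AllPairs; []; _∷_)
import Data.List.Relation.Unary.AllPairs.Properties as AllPairsₚ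
open import Relation.Nullary using (¬_; yes; no; Dec)
open import Relation.Nullary.Decidable using (_×-dec_; ¬?)
open import Relation.Binary.Bundles using (Setoid)
open import Relation.Binary.Structures using (IsEquivalence)
open import Relation.Binary.Core using (_⇒_; _=[_]⇒_)
open import Relation.Unary using (_⊆_)
import Relation.Binary.Reasoning.Setoid
open import Relation.Binary.PropositionalEquality hiding ([_])
open import Function.Definitions using (Injective)
open import Function.Bundles using (_⇔_; mk⇔; Equivalence)
open import Function.Properties.Equivalence using () renaming (sym to ⇔-sym; trans to ⇔-trans)
open import Defs renaming (refl to reflect)

open +-*-Solver

-- Arithmetic modulo n

module Congruence (n : ℕ) .{{_ : NonZero n}} where

  infix 4 _≈_
  record _≈_ (x y : ℕ) : Set where
    constructor mk≈
    field ≈⇒%≡ : x % n ≡ y % n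

  open _≈_ public

  ≈-isEquivalence : IsEquivalence _≈_
  ≈-isEquivalence = record
    { refl  = mk≈ refl
    ; sym   = λ x≈y → mk≈ (sym (≈⇒%≡ x≈y))
    ; trans = λ x≈y y≈z → mk≈ (trans (≈⇒%≡ x≈y) (≈⇒%≡ y≈z))
    }

  ≈-setoid : Setoid 0ℓ 0ℓ
  ≈-setoid = record { isEquivalence = ≈-isEquivalence }

  open IsEquivalence ≈-isEquivalence public
    using () renaming (refl to ≈-refl; sym to ≈-sym; trans to ≈-trans)

  module ≈-Reasoning = Relation.Binary.Reasoning.Setoid ≈-setoid

  ≡⇒≈ : ∀ {x y} → x ≡ y → x ≈ y
  ≡⇒≈ refl = ≈-refl

  m%n≈m : ∀ m → m % n ≈ m
  m%n≈m m = mk≈ (m%n%n≡m%n m n)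

  +-cong : ∀ {a b c d} → a ≈ b → c ≈ d → a + c ≈ b + d
  +-cong {a} {b} {c} {d} (mk≈ a≈b) (mk≈ c≈d) = mk≈ (begin
    (a + c) % n          ≡⟨ %-distribˡ-+ a c n ⟩
    (a % n + c % n) % n  ≡⟨ cong₂ (λ x y → (x + y) % n) a≈b c≈d ⟩
    (b % n + d % n) % n  ≡⟨ %-distribˡ-+ b d n ⟨
    (b + d) % n          ∎)
    where open ≡-Reasoning

  *-cong : ∀ {a b c d} → a ≈ b → c ≈ d → a * c ≈ b * d
  *-cong {a} {b} {c} {d} (mk≈ a≈b) (mk≈ c≈d) = mk≈ (begin
    (a * c) % n            ≡⟨ %-distribˡ-* a c n ⟩
    (a % n * (c % n)) % n  ≡⟨ cong₂ (λ x y → (x * y) % n) a≈b c≈d ⟩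
    (b % n * (d % n)) % n  ≡⟨ %-distribˡ-* b d n ⟨
    (b * d) % n            ∎)
    where open ≡-Reasoning

  +-congˡ : ∀ a {b c} → b ≈ c → a + b ≈ a + c
  +-congˡ a = +-cong (≈-refl {a})

  +-congʳ : ∀ a {b c} → b ≈ c → b + a ≈ c + a
  +-congʳ a b≈c = +-cong b≈c (≈-refl {a})

  0%n≡0 : 0 % n ≡ 0
  0%n≡0 = m<n⇒m%n≡m (>-nonZero⁻¹ n)

  m*n≈0 : ∀ m → m * n ≈ 0
  m*n≈0 m = mk≈ (trans (m*n%n≡0 m n) (sym 0%n≡0))

  n≈0 : n ≈ 0
  n≈0 = mk≈ (trans (n%n≡0 n) (sym 0%n≡0))

  m+n≈m : ∀ m → m + n ≈ m
  m+n≈m m = mk≈ ([m+n]%n≡m%n m n)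

  -- pred n * m plays the role of - m
  m+pred[n]*m≈0 : ∀ m → m + pred n * m ≈ 0
  m+pred[n]*m≈0 m = ≈-trans (≡⇒≈ (trans (cong (_* m) (suc-pred n)) (*-comm n m))) (m*n≈0 m)

  +-cancelʳ-≈ : ∀ c {a b} → a + c ≈ b + c → a ≈ b
  +-cancelʳ-≈ c {a} {b} h = begin
    a              ≡⟨ +-identityʳ a ⟨
    a + 0          ≈⟨ +-congˡ a (m+pred[n]*m≈0 c) ⟨
    a + (c + c′)   ≡⟨ +-assoc a c c′ ⟨
    a + c + c′     ≈⟨ +-congʳ c′ h ⟩
    b + c + c′     ≡⟨ +-assoc b c c′ ⟩
    b + (c + c′)   ≈⟨ +-congˡ b (m+pred[n]*m≈0 c) ⟩
    b + 0          ≡⟨ +-identityʳ b ⟩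
    b              ∎
    where
    open ≈-Reasoning
    c′ = pred n * c

  +-cancelˡ-≈ : ∀ c {a b} → c + a ≈ c + b → a ≈ b
  +-cancelˡ-≈ c {a} {b} h = +-cancelʳ-≈ c (subst₂ _≈_ (+-comm c a) (+-comm c b) h)

  ≈⇒≡ : ∀ {a b} → a < n → b < n → a ≈ b → a ≡ b
  ≈⇒≡ {a} {b} a<n b<n (mk≈ a≈b) = trans (sym (m<n⇒m%n≡m a<n)) (trans a≈b (m<n⇒m%n≡m b<n))

  ∣⇒≈0 : ∀ {a} → n ∣ a → a ≈ 0
  ∣⇒≈0 {a} n∣a = mk≈ (trans (n∣m⇒m%n≡0 a n n∣a) (sym 0%n≡0))

  ≈0⇒∣ : ∀ {a} → a ≈ 0 → n ∣ a
  ≈0⇒∣ {a} (mk≈ a≈0) = m%n≡0⇒n∣m a n (trans a≈0 0%n≡0)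

  ∣∧<⇒≡0 : ∀ {x} → n ∣ x → x < n → x ≡ 0
  ∣∧<⇒≡0 {zero}  _   _   = refl
  ∣∧<⇒≡0 {suc x} n∣x x<n = ⊥-elim (<⇒≱ x<n (∣⇒≤ n∣x))

  toℕ-mod≈ : ∀ x → toℕ (x mod n) ≈ x
  toℕ-mod≈ x = ≈-trans (≡⇒≈ (toℕ-fromℕ< (m%n<n x n))) (m%n≈m x)

  toℕ-≈-injective : ∀ {i j : Fin n} → toℕ i ≈ toℕ j → i ≡ j
  toℕ-≈-injective {i} {j} i≈j = toℕ-injective (≈⇒≡ (toℕ<n i) (toℕ<n j) i≈j)

  ≡⇒toℕ-≈ : ∀ {i j : Fin n} → i ≡ j → toℕ i ≈ toℕ j
  ≡⇒toℕ-≈ refl = ≈-refl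

  mod-cong : ∀ {x y} → x ≈ y → x mod n ≡ y mod n
  mod-cong {x} {y} x≈y = toℕ-≈-injective (≈-trans (toℕ-mod≈ x) (≈-trans x≈y (≈-sym (toℕ-mod≈ y))))

  mod-injective : ∀ {x y} → x mod n ≡ y mod n → x ≈ y
  mod-injective {x} {y} eq = ≈-trans (≈-sym (toℕ-mod≈ x)) (≈-trans (≡⇒toℕ-≈ eq) (toℕ-mod≈ y))

  toℕ-mod : ∀ (i : Fin n) → toℕ i mod n ≡ i
  toℕ-mod i = toℕ-≈-injective (toℕ-mod≈ (toℕ i))

injective⇒surjective : ∀ {k} (f : Fin k → Fin k) → Injective _≡_ _≡_ f → ∀ y → ∃ λ x → f x ≡ y
injective⇒surjective {suc k} f f-inj y with any? (λ x → f x Data.Fin.Properties.≟ y)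
... | yes hit = hit
... | no miss = ⊥-elim (n≮n k (injective⇒≤ {f = g} g-inj))
  where
  -- if y is missed, punching it out of the codomain gives an injection Fin (suc k) → Fin k
  g : Fin (suc k) → Fin k
  g x = punchOut {i = y} {j = f x} (λ eq → miss (x , sym eq))
  g-inj : Injective _≡_ _≡_ g
  g-inj {a} {b} eq = f-inj (punchOut-injective (λ e → miss (a , sym e)) (λ e → miss (b , sym e)) eq)

module PrimeModulus (p : ℕ) .{{_ : NonZero p}} (p-prime : Prime p) where

  open Congruence p public

  ≈⇒∣∸ : ∀ {a b} → a ≤ b → a ≈ b → p ∣ b ∸ a
  ≈⇒∣∸ {a} {b} a≤b a≈b = ≈0⇒∣ (+-cancelʳ-≈ a (begin
    b ∸ a + a  ≡⟨ m∸n+n≡m a≤b ⟩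
    b          ≈⟨ ≈-sym a≈b ⟩
    a          ∎))
    where open ≈-Reasoning

  *-cancelʳ-≈ : ∀ {c} → ¬ (p ∣ c) → ∀ {a b} → a < p → b < p → a * c ≈ b * c → a ≡ b
  *-cancelʳ-≈ {c} p∤c {a} {b} a<p b<p ac≈bc = [ a≤b⇒a≡b , b≤a⇒a≡b ]′ (≤-total a b)
    where
    ≤⇒≥ : ∀ {x y} → x ≤ y → y < p → x * c ≈ y * c → y ≤ x
    ≤⇒≥ {x} {y} x≤y y<p xc≈yc =
      m∸n≡0⇒m≤n ([ (λ p∣y∸x → ∣∧<⇒≡0 p∣y∸x (≤-<-trans (m∸n≤m y x) y<p)) , (λ p∣c → ⊥-elim (p∤c p∣c)) ]′
        (euclidsLemma (y ∸ x) c p-prime (subst (p ∣_) (sym (*-distribʳ-∸ c y x)) (≈⇒∣∸ (*-monoˡ-≤ c x≤y) xc≈yc))))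
    a≤b⇒a≡b : a ≤ b → a ≡ b
    a≤b⇒a≡b a≤b = ≤-antisym a≤b (≤⇒≥ a≤b b<p ac≈bc)
    b≤a⇒a≡b : b ≤ a → a ≡ b
    b≤a⇒a≡b b≤a = ≤-antisym (≤⇒≥ b≤a a<p (≈-sym ac≈bc)) b≤a

  UniqueRoot : ℕ → ℕ → Set
  UniqueRoot k c = ∃ λ r → r < p × k * r + c ≈ 0 × (∀ a → a < p → k * a + c ≈ 0 → a ≡ r)

  -- the root exists because x ↦ k x + c is injective, hence surjective, on residues
  affine-root : ∀ {k} c → ¬ (p ∣ k) → UniqueRoot k c
  affine-root {k} c p∤k = from-preimage (injective⇒surjective f f-injective (0 mod p))
    where
    cancel : ∀ {a b} → a < p → b < p → k * a + c ≈ k * b + c → a ≡ b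
    cancel {a} {b} a<p b<p h =
      *-cancelʳ-≈ p∤k a<p b<p (subst₂ _≈_ (*-comm k a) (*-comm k b) (+-cancelʳ-≈ c h))
    f : Fin p → Fin p
    f x = (k * toℕ x + c) mod p
    f-injective : Injective _≡_ _≡_ f
    f-injective {x} {y} eq = toℕ-injective (cancel (toℕ<n x) (toℕ<n y) (mod-injective eq))
    from-preimage : (∃ λ x → f x ≡ 0 mod p) → UniqueRoot k c
    from-preimage (x , fx≡0) = toℕ x , toℕ<n x , root ,
      λ a a<p ka+c≈0 → cancel a<p (toℕ<n x) (≈-trans ka+c≈0 (≈-sym root))
      where
      root : k * toℕ x + c ≈ 0
      root = mod-injective fx≡0

cyclic-order : ∀ {a b} → a < 3 → b < 3 → a ≢ b → b ≡ (a + 1) % 3 ⊎ a ≡ (b + 1) % 3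
cyclic-order {0} {0} _ _ a≢b = ⊥-elim (a≢b refl)
cyclic-order {0} {1} _ _ _   = inj₁ refl
cyclic-order {0} {2} _ _ _   = inj₂ refl
cyclic-order {1} {0} _ _ _   = inj₂ refl
cyclic-order {1} {1} _ _ a≢b = ⊥-elim (a≢b refl)
cyclic-order {1} {2} _ _ _   = inj₁ refl
cyclic-order {2} {0} _ _ _   = inj₁ refl
cyclic-order {2} {1} _ _ _   = inj₂ refl
cyclic-order {2} {2} _ _ a≢b = ⊥-elim (a≢b refl)
cyclic-order {suc (suc (suc _))} (s≤s (s≤s (s≤s ()))) _ _
cyclic-order {_} {suc (suc (suc _))} _ (s≤s (s≤s (s≤s ()))) _

third-residue : ∀ {a x} → a < 3 → x < 3 → x ≢ a → x ≢ (a + 1) % 3 → x ≡ ((a + 1) % 3 + 1) % 3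
third-residue {0} {0} _ _ x≢a _ = ⊥-elim (x≢a refl)
third-residue {0} {1} _ _ _ x≢b = ⊥-elim (x≢b refl)
third-residue {0} {2} _ _ _ _   = refl
third-residue {1} {0} _ _ _ _   = refl
third-residue {1} {1} _ _ x≢a _ = ⊥-elim (x≢a refl)
third-residue {1} {2} _ _ _ x≢b = ⊥-elim (x≢b refl)
third-residue {2} {0} _ _ _ x≢b = ⊥-elim (x≢b refl)
third-residue {2} {1} _ _ _ _   = refl
third-residue {2} {2} _ _ x≢a _ = ⊥-elim (x≢a refl)
third-residue {suc (suc (suc _))} (s≤s (s≤s (s≤s ()))) _ _ _
third-residue {_} {suc (suc (suc _))} _ (s≤s (s≤s (s≤s ()))) _ _

sum-rotate₃ : ∀ (f : ℕ → ℕ) r → r < 3 → f (r % 3) + f ((1 + r) % 3) + f ((2 + r) % 3) ≡ f 0 + f 1 + f 2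
sum-rotate₃ f 0 _ = refl
sum-rotate₃ f 1 _ = solve 3 (λ a b c → b :+ c :+ a := a :+ b :+ c) refl (f 0) (f 1) (f 2)
sum-rotate₃ f 2 _ = solve 3 (λ a b c → c :+ a :+ b := a :+ b :+ c) refl (f 0) (f 1) (f 2)
sum-rotate₃ f (suc (suc (suc _))) (s≤s (s≤s (s≤s ())))

induction₃ : ∀ (Q : ℕ → Set) → Q 0 → Q 1 → Q 2 → (∀ t → Q t → Q (3 + t)) → ∀ t → Q t
induction₃ Q q₀ q₁ q₂ step 0 = q₀
induction₃ Q q₀ q₁ q₂ step 1 = q₁
induction₃ Q q₀ q₁ q₂ step 2 = q₂
induction₃ Q q₀ q₁ q₂ step (suc (suc (suc t))) = step t (induction₃ Q q₀ q₁ q₂ step t)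

-- Finite sums and counting

sum< : ℕ → (ℕ → ℕ) → ℕ
sum< zero    f = 0
sum< (suc N) f = sum< N f + f N

syntax sum< N (λ i → x) = ∑[ i < N ] x

∑-cong : ∀ N {f g : ℕ → ℕ} → (∀ i → i < N → f i ≡ g i) → ∑[ i < N ] f i ≡ ∑[ i < N ] g i
∑-cong zero    f≡g = refl
∑-cong (suc N) f≡g = cong₂ _+_ (∑-cong N (λ i i<N → f≡g i (m<n⇒m<1+n i<N))) (f≡g N ≤-refl)

∑-distrib-+ : ∀ N (f g : ℕ → ℕ) → ∑[ i < N ] (f i + g i) ≡ ∑[ i < N ] f i + ∑[ i < N ] g i
∑-distrib-+ zero    f g = refl
∑-distrib-+ (suc N) f g = trans (cong (_+ (f N + g N)) (∑-distrib-+ N f g))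
  (solve 4 (λ a b c d → a :+ b :+ (c :+ d) := a :+ c :+ (b :+ d)) refl (sum< N f) (sum< N g) (f N) (g N))

*-distribˡ-∑ : ∀ N k (f : ℕ → ℕ) → ∑[ i < N ] (k * f i) ≡ k * ∑[ i < N ] f i
*-distribˡ-∑ zero    k f = sym (*-zeroʳ k)
*-distribˡ-∑ (suc N) k f = trans (cong (_+ k * f N) (*-distribˡ-∑ N k f)) (sym (*-distribˡ-+ k (sum< N f) (f N)))

*-distribʳ-∑ : ∀ N k (f : ℕ → ℕ) → ∑[ i < N ] (f i * k) ≡ (∑[ i < N ] f i) * k
*-distribʳ-∑ N k f = trans (∑-cong N (λ i _ → *-comm (f i) k)) (trans (*-distribˡ-∑ N k f) (*-comm k (sum< N f)))

∑-const : ∀ N k → ∑[ i < N ] k ≡ N * k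
∑-const zero    k = refl
∑-const (suc N) k = trans (cong (_+ k) (∑-const N k)) (+-comm (N * k) k)

∑-comm : ∀ M N (f : ℕ → ℕ → ℕ) → ∑[ i < M ] ∑[ j < N ] f i j ≡ ∑[ j < N ] ∑[ i < M ] f i j
∑-comm zero    N f = sym (trans (∑-const N 0) (*-zeroʳ N))
∑-comm (suc M) N f = trans (cong (_+ sum< N (f M)) (∑-comm M N f))
  (sym (∑-distrib-+ N (λ j → ∑[ i < M ] f i j) (f M)))

∑-+ : ∀ M N (f : ℕ → ℕ) → ∑[ i < M + N ] f i ≡ ∑[ i < M ] f i + ∑[ j < N ] f (M + j)
∑-+ M zero    f = trans (cong (λ K → sum< K f) (+-identityʳ M)) (sym (+-identityʳ (sum< M f)))
∑-+ M (suc N) f = trans (cong (λ K → sum< K f) (+-suc M N))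
  (trans (cong (_+ f (M + N)) (∑-+ M N f)) (+-assoc (sum< M f) _ _))

∑-* : ∀ M N (f : ℕ → ℕ) → ∑[ k < M * N ] f k ≡ ∑[ i < M ] ∑[ j < N ] f (j + i * N)
∑-* zero    N f = refl
∑-* (suc M) N f = trans (cong (λ K → sum< K f) (+-comm N (M * N)))
  (trans (∑-+ (M * N) N f) (cong₂ _+_ (∑-* M N f) (∑-cong N (λ j _ → cong f (+-comm (M * N) j)))))

∑-rotate : ∀ N .{{_ : NonZero N}} a → a < N → (h : ℕ → ℕ) → ∑[ g < N ] h ((a + g) % N) ≡ ∑[ g < N ] h g
∑-rotate N a a<N h = begin
  ∑[ g < N ] h ((a + g) % N)                         ≡⟨ cong (λ K → sum< K (λ g → h ((a + g) % N))) m+a≡N ⟨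
  ∑[ g < m + a ] h ((a + g) % N)                     ≡⟨ ∑-+ m a (λ g → h ((a + g) % N)) ⟩
  ∑[ g < m ] h ((a + g) % N) + ∑[ j < a ] h ((a + (m + j)) % N)
      ≡⟨ cong₂ _+_ (∑-cong m (λ g g<m → cong h (m<n⇒m%n≡m (a+g<N g<m)))) (∑-cong a (λ j j<a → cong h (wrap j j<a))) ⟩
  ∑[ g < m ] h (a + g) + ∑[ j < a ] h j              ≡⟨ +-comm (sum< m (λ g → h (a + g))) (sum< a h) ⟩
  ∑[ j < a ] h j + ∑[ g < m ] h (a + g)              ≡⟨ ∑-+ a m h ⟨
  ∑[ g < a + m ] h g                                 ≡⟨ cong (λ K → sum< K h) (trans (+-comm a m) m+a≡N) ⟩
  ∑[ g < N ] h g                                     ∎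
  where
  open ≡-Reasoning
  m = N ∸ a
  m+a≡N : m + a ≡ N
  m+a≡N = m∸n+n≡m (<⇒≤ a<N)
  a+g<N : ∀ {g} → g < m → a + g < N
  a+g<N g<m = subst (_ <_) (trans (+-comm a m) m+a≡N) (+-monoʳ-< a g<m)
  wrap : ∀ j → j < a → (a + (m + j)) % N ≡ j
  wrap j j<a = begin
    (a + (m + j)) % N  ≡⟨ cong (_% N) (trans (sym (+-assoc a m j)) (cong (_+ j) (trans (+-comm a m) m+a≡N))) ⟩
    (N + j) % N        ≡⟨ cong (_% N) (+-comm N j) ⟩
    (j + N) % N        ≡⟨ [m+n]%n≡m%n j N ⟩
    j % N              ≡⟨ m<n⇒m%n≡m (<-trans j<a a<N) ⟩
    j                  ∎

𝟙[_] : ∀ {P : Set} → Dec P → ℕ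
𝟙[ yes _ ] = 1
𝟙[ no _ ]  = 0

𝟙-yes : ∀ {P : Set} (P? : Dec P) → P → 𝟙[ P? ] ≡ 1
𝟙-yes (yes _) _ = refl
𝟙-yes (no ¬p) p = ⊥-elim (¬p p)

𝟙-no : ∀ {P : Set} (P? : Dec P) → ¬ P → 𝟙[ P? ] ≡ 0
𝟙-no (yes p) ¬p = ⊥-elim (¬p p)
𝟙-no (no _)  _  = refl

𝟙-× : ∀ {P Q : Set} (P? : Dec P) (Q? : Dec Q) → 𝟙[ P? ×-dec Q? ] ≡ 𝟙[ P? ] * 𝟙[ Q? ]
𝟙-× (yes _) (yes _) = refl
𝟙-× (yes _) (no _)  = refl
𝟙-× (no _)  _       = refl

𝟙-cong : ∀ {P Q : Set} (P? : Dec P) (Q? : Dec Q) → P ⇔ Q → 𝟙[ P? ] ≡ 𝟙[ Q? ]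
𝟙-cong (yes p) Q? P⇔Q = sym (𝟙-yes Q? (Equivalence.to P⇔Q p))
𝟙-cong (no ¬p) Q? P⇔Q = sym (𝟙-no Q? (λ q → ¬p (Equivalence.from P⇔Q q)))

𝟙-¬ : ∀ {P : Set} (P? : Dec P) → 𝟙[ ¬? P? ] + 𝟙[ P? ] ≡ 1
𝟙-¬ (yes _) = refl
𝟙-¬ (no _)  = refl

𝟙-*-cong : ∀ {P : Set} (P? : Dec P) {x y} → (P → x ≡ y) → 𝟙[ P? ] * x ≡ 𝟙[ P? ] * y
𝟙-*-cong (yes p) x≡y = cong (1 *_) (x≡y p)
𝟙-*-cong (no _)  _   = refl

count-≡ : ∀ N {a} → a < N → ∑[ j < N ] 𝟙[ j ≟ a ] ≡ 1
count-≡ (suc N) {a} a<1+N with a ≟ N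
... | yes refl = trans (cong (_+ 𝟙[ N ≟ N ]) (none N ≤-refl)) (𝟙-yes (N ≟ N) refl)
  where
  none : ∀ M → M ≤ N → ∑[ j < M ] 𝟙[ j ≟ N ] ≡ 0
  none zero    _   = refl
  none (suc M) M<N = trans (cong₂ _+_ (none M (<⇒≤ M<N)) (𝟙-no (M ≟ N) (<⇒≢ M<N))) refl
... | no a≢N = cong₂ _+_ (count-≡ N (≤∧≢⇒< (s≤s⁻¹ a<1+N) a≢N)) (𝟙-no (N ≟ a) (≢-sym a≢N))

count-≢ : ∀ N {a} → a < N → ∑[ j < N ] 𝟙[ ¬? (j ≟ a) ] ≡ N ∸ 1
count-≢ N {a} a<N = sym (begin
  N ∸ 1                                                  ≡⟨ cong (_∸ 1) all ⟨
  ∑[ j < N ] (𝟙[ ¬? (j ≟ a) ] + 𝟙[ j ≟ a ]) ∸ 1          ≡⟨ cong (_∸ 1) (∑-distrib-+ N _ _) ⟩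
  ∑[ j < N ] 𝟙[ ¬? (j ≟ a) ] + ∑[ j < N ] 𝟙[ j ≟ a ] ∸ 1
    ≡⟨ cong (λ x → ∑[ j < N ] 𝟙[ ¬? (j ≟ a) ] + x ∸ 1) (count-≡ N a<N) ⟩
  ∑[ j < N ] 𝟙[ ¬? (j ≟ a) ] + 1 ∸ 1                    ≡⟨ m+n∸n≡m _ 1 ⟩
  ∑[ j < N ] 𝟙[ ¬? (j ≟ a) ]                            ∎)
  where
  open ≡-Reasoning
  all : ∑[ j < N ] (𝟙[ ¬? (j ≟ a) ] + 𝟙[ j ≟ a ]) ≡ N
  all = trans (∑-cong N (λ j _ → 𝟙-¬ (j ≟ a))) (trans (∑-const N 1) (*-identityʳ N))

count-≢₂ : ∀ N {a b} → a < N → b < N → a ≢ b → ∑[ j < N ] 𝟙[ ¬? (j ≟ a) ×-dec ¬? (j ≟ b) ] ≡ N ∸ 2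
count-≢₂ N {a} {b} a<N b<N a≢b = sym (begin
  N ∸ 2                           ≡⟨ cong (_∸ 2) all ⟨
  ∑[ j < N ] X j + 1 + 1 ∸ 2      ≡⟨ cong (_∸ 2) (+-assoc (∑[ j < N ] X j) 1 1) ⟩
  ∑[ j < N ] X j + 2 ∸ 2          ≡⟨ m+n∸n≡m _ 2 ⟩
  ∑[ j < N ] X j                  ∎)
  where
  open ≡-Reasoning
  X : ℕ → ℕ
  X j = 𝟙[ ¬? (j ≟ a) ×-dec ¬? (j ≟ b) ]
  partition : ∀ {j} (j≟a : Dec (j ≡ a)) (j≟b : Dec (j ≡ b)) → 𝟙[ ¬? j≟a ×-dec ¬? j≟b ] + 𝟙[ j≟a ] + 𝟙[ j≟b ] ≡ 1
  partition (yes refl) (yes refl) = ⊥-elim (a≢b refl)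
  partition (yes _)    (no _)     = refl
  partition (no _)     (yes _)    = refl
  partition (no _)     (no _)     = refl
  all : ∑[ j < N ] X j + 1 + 1 ≡ N
  all = begin
    ∑[ j < N ] X j + 1 + 1
      ≡⟨ cong₂ (λ u v → ∑[ j < N ] X j + u + v) (count-≡ N a<N) (count-≡ N b<N) ⟨
    ∑[ j < N ] X j + ∑[ j < N ] 𝟙[ j ≟ a ] + ∑[ j < N ] 𝟙[ j ≟ b ]
      ≡⟨ cong (_+ ∑[ j < N ] 𝟙[ j ≟ b ]) (∑-distrib-+ N X _) ⟨
    ∑[ j < N ] (X j + 𝟙[ j ≟ a ]) + ∑[ j < N ] 𝟙[ j ≟ b ]
      ≡⟨ ∑-distrib-+ N _ _ ⟨
    ∑[ j < N ] (X j + 𝟙[ j ≟ a ] + 𝟙[ j ≟ b ])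
      ≡⟨ ∑-cong N (λ j _ → partition (j ≟ a) (j ≟ b)) ⟩
    ∑[ j < N ] 1
      ≡⟨ trans (∑-const N 1) (*-identityʳ N) ⟩
    N ∎

module Satisfiers {P : ℕ → Set} (P? : ∀ k → Dec (P k)) where

  cons-if : ∀ {k} → Dec (P k) → List (Σ ℕ P) → List (Σ ℕ P)
  cons-if {k} (yes pk) xs = (k , pk) ∷ xs
  cons-if     (no _)   xs = xs

  satisfiers : ℕ → List (Σ ℕ P)
  satisfiers zero    = []
  satisfiers (suc N) = cons-if (P? N) (satisfiers N)

  length-satisfiers : ∀ N → length (satisfiers N) ≡ ∑[ k < N ] 𝟙[ P? k ]
  length-satisfiers zero    = refl
  length-satisfiers (suc N) = trans (length-cons-if (P? N)) (trans (+-comm 𝟙[ P? N ] _) (cong (_+ 𝟙[ P? N ]) (length-satisfiers N)))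
    where
    length-cons-if : (d : Dec (P N)) → length (cons-if d (satisfiers N)) ≡ 𝟙[ d ] + length (satisfiers N)
    length-cons-if (yes _) = refl
    length-cons-if (no _)  = refl

  satisfiers-< : ∀ N → All (λ x → proj₁ x < N) (satisfiers N)
  satisfiers-< zero    = []
  satisfiers-< (suc N) = all-< (P? N)
    where
    all-< : (d : Dec (P N)) → All (λ x → proj₁ x < suc N) (cons-if d (satisfiers N))
    all-< (yes _) = ≤-refl ∷ All.map m<n⇒m<1+n (satisfiers-< N)
    all-< (no _)  = All.map m<n⇒m<1+n (satisfiers-< N)

  satisfiers-decreasing : ∀ N → AllPairs (λ x y → proj₁ y < proj₁ x) (satisfiers N)
  satisfiers-decreasing zero    = []
  satisfiers-decreasing (suc N) = decreasing (P? N)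
    where
    decreasing : (d : Dec (P N)) → AllPairs (λ x y → proj₁ y < proj₁ x) (cons-if d (satisfiers N))
    decreasing (yes _) = satisfiers-< N ∷ satisfiers-decreasing N
    decreasing (no _)  = satisfiers-decreasing N

  satisfiers-complete : ∀ N {k} → k < N → P k → Any (λ x → proj₁ x ≡ k) (satisfiers N)
  satisfiers-complete (suc N) {k} k<1+N pk = found (k ≟ N) (P? N)
    where
    found : Dec (k ≡ N) → (d : Dec (P N)) → Any (λ x → proj₁ x ≡ k) (cons-if d (satisfiers N))
    found (yes refl) (yes _)  = here refl
    found (yes refl) (no ¬pk) = ⊥-elim (¬pk pk)
    found (no k≢N)   (yes _)  = there (satisfiers-complete N (≤∧≢⇒< (s≤s⁻¹ k<1+N) k≢N) pk)
    found (no k≢N)   (no _)   = satisfiers-complete N (≤∧≢⇒< (s≤s⁻¹ k<1+N) k≢N) pk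

-- Vertices, classes, rotations and reflections

module Vertices (m : ℕ) .{{_ : NonZero m}} where

  n : ℕ
  n = 3 * m

  instance
    n-nonZero : NonZero n
    n-nonZero = m*n≢0 3 m

  open Congruence n public
  module Mod3 = Congruence 3

  ≈⇒≈₃ : ∀ {a b} → a ≈ b → a Mod3.≈ b
  ≈⇒≈₃ {a} {b} (mk≈ a≈b) = Mod3.mk≈
    (trans (sym (m∣n⇒o%n%m≡o%m 3 n a 3∣n)) (trans (cong (_% 3) a≈b) (m∣n⇒o%n%m≡o%m 3 n b 3∣n)))
    where
    3∣n : 3 ∣ n
    3∣n = divides m (*-comm 3 m)

  infixl 6 _⊕_
  _⊕_ : Fin n → ℕ → Fin n
  x ⊕ c = rot n c x

  toℕ-⊕ : ∀ x c → toℕ (x ⊕ c) ≈ toℕ x + c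
  toℕ-⊕ x c = toℕ-mod≈ (toℕ x + c)

  ⊕-assoc : ∀ x a b → x ⊕ a ⊕ b ≡ x ⊕ (a + b)
  ⊕-assoc x a b = toℕ-≈-injective (begin
    toℕ (x ⊕ a ⊕ b)    ≈⟨ toℕ-⊕ (x ⊕ a) b ⟩
    toℕ (x ⊕ a) + b    ≈⟨ +-congʳ b (toℕ-⊕ x a) ⟩
    toℕ x + a + b      ≡⟨ +-assoc (toℕ x) a b ⟩
    toℕ x + (a + b)    ≈⟨ toℕ-⊕ x (a + b) ⟨
    toℕ (x ⊕ (a + b))  ∎)
    where open ≈-Reasoning

  ⊕-congˡ : ∀ x {a b} → a ≈ b → x ⊕ a ≡ x ⊕ b
  ⊕-congˡ x {a} {b} a≈b =
    toℕ-≈-injective (≈-trans (toℕ-⊕ x a) (≈-trans (+-congˡ (toℕ x) a≈b) (≈-sym (toℕ-⊕ x b))))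

  ⊕-comm : ∀ x a b → x ⊕ a ⊕ b ≡ x ⊕ b ⊕ a
  ⊕-comm x a b = begin
    x ⊕ a ⊕ b    ≡⟨ ⊕-assoc x a b ⟩
    x ⊕ (a + b)  ≡⟨ cong (x ⊕_) (+-comm a b) ⟩
    x ⊕ (b + a)  ≡⟨ ⊕-assoc x b a ⟨
    x ⊕ b ⊕ a    ∎
    where open ≡-Reasoning

  ⊕-identityʳ : ∀ x → x ⊕ 0 ≡ x
  ⊕-identityʳ x = toℕ-≈-injective (≈-trans (toℕ-⊕ x 0) (≡⇒≈ (+-identityʳ (toℕ x))))

  ⊕-cancelʳ : ∀ c {x y} → x ⊕ c ≡ y ⊕ c → x ≡ y
  ⊕-cancelʳ c {x} {y} eq = toℕ-≈-injective (+-cancelʳ-≈ c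
    (≈-trans (≈-sym (toℕ-⊕ x c)) (≈-trans (≡⇒toℕ-≈ eq) (toℕ-⊕ y c))))

  ⊕-cancelˡ : ∀ x {a b} → x ⊕ a ≡ x ⊕ b → a ≈ b
  ⊕-cancelˡ x {a} {b} eq = +-cancelˡ-≈ (toℕ x)
    (≈-trans (≈-sym (toℕ-⊕ x a)) (≈-trans (≡⇒toℕ-≈ eq) (toℕ-⊕ x b)))

  ⊕-fixed⇒≈0 : ∀ x {a} → x ⊕ a ≡ x → a ≈ 0
  ⊕-fixed⇒≈0 x eq = ⊕-cancelˡ x (trans eq (sym (⊕-identityʳ x)))

  infixl 6 _⊖_
  _⊖_ : Fin n → Fin n → ℕ
  y ⊖ x = toℕ y + pred n * toℕ x

  ⊕-⊖ : ∀ x y → x ⊕ (y ⊖ x) ≡ y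
  ⊕-⊖ x y = toℕ-≈-injective (begin
    toℕ (x ⊕ (y ⊖ x))                 ≈⟨ toℕ-⊕ x (y ⊖ x) ⟩
    toℕ x + (toℕ y + pred n * toℕ x)
      ≡⟨ solve 3 (λ a b c → a :+ (b :+ c) := b :+ (a :+ c)) refl (toℕ x) (toℕ y) (pred n * toℕ x) ⟩
    toℕ y + (toℕ x + pred n * toℕ x)  ≈⟨ +-congˡ (toℕ y) (m+pred[n]*m≈0 (toℕ x)) ⟩
    toℕ y + 0                         ≡⟨ +-identityʳ (toℕ y) ⟩
    toℕ y                             ∎)
    where open ≈-Reasoning

  cls : Fin n → ℕ
  cls x = toℕ x % 3

  cls<3 : ∀ x → cls x < 3
  cls<3 x = m%n<n (toℕ x) 3

  cls-⊕ : ∀ x c → cls (x ⊕ c) ≡ (cls x + c) % 3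
  cls-⊕ x c = Mod3.≈⇒%≡ (Mod3.≈-trans (≈⇒≈₃ (toℕ-⊕ x c)) (Mod3.≈-sym (Mod3.+-congʳ c (Mod3.m%n≈m (toℕ x)))))

  cls-⊕-3* : ∀ x i → cls (x ⊕ 3 * i) ≡ cls x
  cls-⊕-3* x i = begin
    cls (x ⊕ 3 * i)      ≡⟨ cls-⊕ x (3 * i) ⟩
    (cls x + 3 * i) % 3  ≡⟨ cong (λ k → (cls x + k) % 3) (*-comm 3 i) ⟩
    (cls x + i * 3) % 3  ≡⟨ [m+kn]%n≡m%n (cls x) i 3 ⟩
    cls x % 3            ≡⟨ m%n%n≡m%n (toℕ x) 3 ⟩
    cls x                ∎
    where open ≡-Reasoning

  same-cls⇒⊕3* : ∀ x y → cls x ≡ cls y → x ≢ y → ∃ λ i → 1 ≤ i × i < m × y ≡ x ⊕ 3 * i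
  same-cls⇒⊕3* x y cx≡cy x≢y = from-divisor (m%n≡0⇒n∣m d 3 d%3≡0)
    where
    d : ℕ
    d = (y ⊖ x) % n
    x⊕d≡y : x ⊕ d ≡ y
    x⊕d≡y = trans (⊕-congˡ x (m%n≈m (y ⊖ x))) (⊕-⊖ x y)
    from-divisor : 3 ∣ d → ∃ λ i → 1 ≤ i × i < m × y ≡ x ⊕ 3 * i
    from-divisor (divides i d≡i*3) = i , 1≤i , i<m , trans (sym x⊕d≡y) (⊕-congˡ x (≡⇒≈ d≡3*i))
      where
      d≡3*i : d ≡ 3 * i
      d≡3*i = trans d≡i*3 (*-comm i 3)
      1≤i : 1 ≤ i
      1≤i = n≢0⇒n>0 λ i≡0 → x≢y (trans (sym (⊕-identityʳ x))
              (trans (⊕-congˡ x (≡⇒≈ (sym (trans d≡3*i (cong (3 *_) i≡0))))) x⊕d≡y))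
      i<m : i < m
      i<m = *-cancelˡ-< 3 i m (subst (_< n) d≡3*i (m%n<n (y ⊖ x) n))
    d%3≡0 : d % 3 ≡ 0
    d%3≡0 = Mod3.≈⇒%≡ (Mod3.+-cancelˡ-≈ (cls x) (Mod3.mk≈ (begin
      (cls x + d) % 3  ≡⟨ cls-⊕ x d ⟨
      cls (x ⊕ d)      ≡⟨ cong cls x⊕d≡y ⟩
      cls y            ≡⟨ cx≡cy ⟨
      cls x            ≡⟨ m%n%n≡m%n (toℕ x) 3 ⟨
      cls x % 3        ≡⟨ cong (_% 3) (+-identityʳ (cls x)) ⟨
      (cls x + 0) % 3  ∎)))
      where open ≡-Reasoning

  reflect-toℕ : ∀ c x → toℕ (reflect n c x) + toℕ x ≈ c
  reflect-toℕ c x = begin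
    toℕ (reflect n c x) + toℕ x    ≈⟨ +-congʳ (toℕ x) (toℕ-mod≈ (c + (n ∸ toℕ x))) ⟩
    c + (n ∸ toℕ x) + toℕ x        ≡⟨ +-assoc c (n ∸ toℕ x) (toℕ x) ⟩
    c + (n ∸ toℕ x + toℕ x)        ≡⟨ cong (c +_) (m∸n+n≡m (<⇒≤ (toℕ<n x))) ⟩
    c + n                          ≈⟨ m+n≈m c ⟩
    c                              ∎
    where open ≈-Reasoning

  reflect-involutive : ∀ c x → reflect n c (reflect n c x) ≡ x
  reflect-involutive c x = toℕ-≈-injective (+-cancelʳ-≈ (toℕ r) (begin
    toℕ (reflect n c r) + toℕ r  ≈⟨ reflect-toℕ c r ⟩
    c                            ≈⟨ reflect-toℕ c x ⟨
    toℕ r + toℕ x                ≡⟨ +-comm (toℕ r) (toℕ x) ⟩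
    toℕ x + toℕ r                ∎))
    where
    open ≈-Reasoning
    r = reflect n c x

  cls-reflect : ∀ c x → cls (reflect n c x) ≡ (c + 2 * cls x) % 3
  cls-reflect c x = Mod3.≈⇒%≡ (begin
    r                ≡⟨ +-identityʳ r ⟨
    r + 0            ≈⟨ Mod3.+-congˡ r (Mod3.m*n≈0 t) ⟨
    r + t * 3        ≡⟨ solve 2 (λ r t → r :+ t :* con 3 := r :+ t :+ con 2 :* t) refl r t ⟩
    r + t + 2 * t    ≈⟨ Mod3.+-congʳ (2 * t) (≈⇒≈₃ (reflect-toℕ c x)) ⟩
    c + 2 * t        ≈⟨ Mod3.+-congˡ c (Mod3.*-cong (Mod3.≈-refl {2}) (Mod3.m%n≈m t)) ⟨
    c + 2 * (t % 3)  ∎)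
    where
    open Mod3.≈-Reasoning
    r = toℕ (reflect n c x)
    t = toℕ x

  vertex : ℕ → Fin n
  vertex k = k mod n

  cls-vertex : ∀ k → k < 3 → cls (vertex k) ≡ k
  cls-vertex k k<3 = begin
    toℕ (k mod n) % 3  ≡⟨ cong (_% 3) (toℕ-fromℕ< (m%n<n k n)) ⟩
    k % n % 3          ≡⟨ cong (_% 3) (m<n⇒m%n≡m (<-≤-trans k<3 (m≤m*n 3 m))) ⟩
    k % 3              ≡⟨ m<n⇒m%n≡m k<3 ⟩
    k                  ∎
    where open ≡-Reasoning

  -- Polygons whose step depends only on the class

  Step : (ℕ → ℕ) → Fin n → Fin n → Set
  Step d x y = y ≡ x ⊕ d (cls x)

  data StepEdge (d : ℕ → ℕ) (x y : Fin n) : Set where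
    forward  : Step d x y → StepEdge d x y
    backward : Step d y x → StepEdge d x y

  StepEdge-sym : ∀ {d x y} → StepEdge d x y → StepEdge d y x
  StepEdge-sym (forward s)  = backward s
  StepEdge-sym (backward s) = forward s

  StepEdge-cong : ∀ {d d′} → (∀ k → k < 3 → d k ≈ d′ k) → StepEdge d ⇒ StepEdge d′
  StepEdge-cong d≈d′ {x} {_} (forward refl)  = forward (⊕-congˡ x (d≈d′ (cls x) (cls<3 x)))
  StepEdge-cong d≈d′ {_} {y} (backward refl) = backward (⊕-congˡ y (d≈d′ (cls y) (cls<3 y)))

  Ascending : (ℕ → ℕ) → Set
  Ascending d = ∀ k → k < 3 → d k % 3 ≡ 1

  cls-Step : ∀ {d} → Ascending d → ∀ {x y} → Step d x y → cls y ≡ (cls x + 1) % 3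
  cls-Step {d} asc {x} refl = begin
    cls (x ⊕ d (cls x))          ≡⟨ cls-⊕ x (d (cls x)) ⟩
    (cls x + d (cls x)) % 3      ≡⟨ Mod3.≈⇒%≡ (Mod3.+-congˡ (cls x) (Mod3.m%n≈m (d (cls x)))) ⟨
    (cls x + d (cls x) % 3) % 3  ≡⟨ cong (λ r → (cls x + r) % 3) (asc (cls x) (cls<3 x)) ⟩
    (cls x + 1) % 3              ∎
    where open ≡-Reasoning

  StepEdge⇒Step : ∀ {d} → Ascending d → ∀ {x y} → StepEdge d x y → cls y ≡ (cls x + 1) % 3 → Step d x y
  StepEdge⇒Step asc (forward s)  _ = s
  StepEdge⇒Step {d} asc {x} {y} (backward s) cy≡cx+1 =
    ⊥-elim (no-2-cycle (cls x) (cls<3 x) (trans (cls-Step {d} asc s) (cong (λ k → (k + 1) % 3) cy≡cx+1)))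
    where
    no-2-cycle : ∀ a → a < 3 → a ≢ ((a + 1) % 3 + 1) % 3
    no-2-cycle 0 _ ()
    no-2-cycle 1 _ ()
    no-2-cycle 2 _ ()
    no-2-cycle (suc (suc (suc _))) (s≤s (s≤s (s≤s ())))

  module _ {d d′ : ℕ → ℕ} (c : ℕ) (d≈d′ : ∀ k → k < 3 → d k ≈ d′ ((k + c) % 3)) where

    ⊕-Step : ∀ x → x ⊕ c ⊕ d′ (cls (x ⊕ c)) ≡ x ⊕ d (cls x) ⊕ c
    ⊕-Step x = begin
      x ⊕ c ⊕ d′ (cls (x ⊕ c))        ≡⟨ cong (λ k → x ⊕ c ⊕ d′ k) (cls-⊕ x c) ⟩
      x ⊕ c ⊕ d′ ((cls x + c) % 3)    ≡⟨ ⊕-congˡ (x ⊕ c) (d≈d′ (cls x) (cls<3 x)) ⟨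
      x ⊕ c ⊕ d (cls x)               ≡⟨ ⊕-comm x c (d (cls x)) ⟩
      x ⊕ d (cls x) ⊕ c               ∎
      where open ≡-Reasoning

    StepEdge-⊕ : ∀ {x y} → StepEdge d x y ⇔ StepEdge d′ (x ⊕ c) (y ⊕ c)
    StepEdge-⊕ = mk⇔ to from
      where
      to : ∀ {x y} → StepEdge d x y → StepEdge d′ (x ⊕ c) (y ⊕ c)
      to {x} (forward refl)  = forward (sym (⊕-Step x))
      to {_} {y} (backward refl) = backward (sym (⊕-Step y))
      from : ∀ {x y} → StepEdge d′ (x ⊕ c) (y ⊕ c) → StepEdge d x y
      from {x} (forward s)  = forward (⊕-cancelʳ c (trans s (⊕-Step x)))
      from {_} {y} (backward s) = backward (⊕-cancelʳ c (trans s (⊕-Step y)))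

  Step-vertex : ∀ d k → k < 3 → Step d (vertex k) (vertex k ⊕ d k)
  Step-vertex d k k<3 = cong (λ j → vertex k ⊕ d j) (sym (cls-vertex k k<3))

  cls-⊕-succ : ∀ c {x y} → cls y ≡ (cls x + 1) % 3 → cls (y ⊕ c) ≡ (cls (x ⊕ c) + 1) % 3
  cls-⊕-succ c {x} {y} cy≡cx+1 = Mod3.≈⇒%≡ (begin
    toℕ (y ⊕ c)                ≈⟨ ≈⇒≈₃ (toℕ-⊕ y c) ⟩
    toℕ y + c                  ≈⟨ Mod3.+-congʳ c (Mod3.mk≈ cy≡cx+1) ⟩
    cls x + 1 + c              ≈⟨ Mod3.+-congʳ c (Mod3.+-congʳ 1 (Mod3.m%n≈m (toℕ x))) ⟩
    toℕ x + 1 + c              ≡⟨ solve 2 (λ a c → a :+ con 1 :+ c := a :+ c :+ con 1) refl (toℕ x) c ⟩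
    toℕ x + c + 1              ≈⟨ Mod3.+-congʳ 1 (≈⇒≈₃ (toℕ-⊕ x c)) ⟨
    toℕ (x ⊕ c) + 1            ≈⟨ Mod3.+-congʳ 1 (Mod3.m%n≈m (toℕ (x ⊕ c))) ⟨
    cls (x ⊕ c) + 1            ∎)
    where open Mod3.≈-Reasoning

  ⊕-determines-steps : ∀ {d d′} c → Ascending d → Ascending d′ → StepEdge d =[ _⊕ c ]⇒ StepEdge d′ →
                       ∀ k → k < 3 → d k ≈ d′ ((k + c) % 3)
  ⊕-determines-steps {d} {d′} c asc asc′ maps k k<3 = ⊕-cancelˡ (x ⊕ c) (begin
    x ⊕ c ⊕ d k               ≡⟨ ⊕-comm x c (d k) ⟩
    x ⊕ d k ⊕ c               ≡⟨ StepEdge⇒Step {d′} asc′ (maps (forward s)) (cls-⊕-succ c (cls-Step {d} asc s)) ⟩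
    x ⊕ c ⊕ d′ (cls (x ⊕ c))  ≡⟨ cong (λ j → x ⊕ c ⊕ d′ j) (trans (cls-⊕ x c) (cong (λ j → (j + c) % 3) (cls-vertex k k<3))) ⟩
    x ⊕ c ⊕ d′ ((k + c) % 3)  ∎)
    where
    open ≡-Reasoning
    x = vertex k
    s = Step-vertex d k k<3

  cls-reflect-succ : ∀ c x y → cls y ≡ (cls x + 1) % 3 → cls (reflect n c y) ≡ (c + 2 * cls x + 2) % 3
  cls-reflect-succ c x y cy≡cx+1 = Mod3.≈⇒%≡ (begin
    toℕ (reflect n c y)         ≈⟨ Mod3.mk≈ (cls-reflect c y) ⟩
    c + 2 * cls y               ≈⟨ Mod3.+-congˡ c (Mod3.*-cong (Mod3.≈-refl {2}) cy≈cx+1) ⟩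
    c + 2 * (cls x + 1)         ≡⟨ solve 2 (λ c a → c :+ con 2 :* (a :+ con 1) := c :+ con 2 :* a :+ con 2) refl c (cls x) ⟩
    c + 2 * cls x + 2           ∎)
    where
    open Mod3.≈-Reasoning
    cy≈cx+1 : cls y Mod3.≈ cls x + 1
    cy≈cx+1 = Mod3.≈-trans (Mod3.m%n≈m (toℕ y)) (Mod3.mk≈ cy≡cx+1)

  cls-reflect-pred : ∀ c x y → cls y ≡ (cls x + 1) % 3 → cls (reflect n c x) ≡ (cls (reflect n c y) + 1) % 3
  cls-reflect-pred c x y cy≡cx+1 = Mod3.≈⇒%≡ (begin
    toℕ (reflect n c x)         ≈⟨ Mod3.mk≈ (cls-reflect c x) ⟩
    c + 2 * cls x               ≡⟨ +-identityʳ (c + 2 * cls x) ⟨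
    c + 2 * cls x + 0           ≈⟨ Mod3.+-congˡ (c + 2 * cls x) Mod3.n≈0 ⟨
    c + 2 * cls x + 3           ≡⟨ +-assoc (c + 2 * cls x) 2 1 ⟨
    c + 2 * cls x + 2 + 1       ≈⟨ Mod3.+-congʳ 1 (Mod3.mk≈ (cls-reflect-succ c x y cy≡cx+1)) ⟨
    toℕ (reflect n c y) + 1     ≈⟨ Mod3.+-congʳ 1 (Mod3.m%n≈m (toℕ (reflect n c y))) ⟨
    cls (reflect n c y) + 1     ∎)
    where open Mod3.≈-Reasoning

  module _ {d d′ : ℕ → ℕ} (c : ℕ) (asc : Ascending d)
           (d≈d′ : ∀ k → k < 3 → d k ≈ d′ ((c + 2 * k + 2) % 3)) where

    reflect-Step : ∀ {x y} → Step d x y → Step d′ (reflect n c y) (reflect n c x)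
    reflect-Step {x} {y} s = toℕ-≈-injective (+-cancelʳ-≈ (toℕ x) (begin
      toℕ (reflect n c x) + toℕ x     ≈⟨ reflect-toℕ c x ⟩
      c                               ≈⟨ reflect-toℕ c y ⟨
      toℕ ry + toℕ y                  ≈⟨ +-congˡ (toℕ ry) (≈-trans (≡⇒toℕ-≈ s) (toℕ-⊕ x (d (cls x)))) ⟩
      toℕ ry + (toℕ x + d (cls x))    ≡⟨ solve 3 (λ a b e → a :+ (b :+ e) := a :+ e :+ b) refl (toℕ ry) (toℕ x) (d (cls x)) ⟩
      toℕ ry + d (cls x) + toℕ x      ≈⟨ +-congʳ (toℕ x) (+-congˡ (toℕ ry) step≈) ⟩
      toℕ ry + d′ (cls ry) + toℕ x    ≈⟨ +-congʳ (toℕ x) (toℕ-⊕ ry (d′ (cls ry))) ⟨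
      toℕ (ry ⊕ d′ (cls ry)) + toℕ x  ∎))
      where
      open ≈-Reasoning
      ry = reflect n c y
      step≈ : d (cls x) ≈ d′ (cls ry)
      step≈ = ≈-trans (d≈d′ (cls x) (cls<3 x))
                (≡⇒≈ (cong d′ (sym (cls-reflect-succ c x y (cls-Step {d} asc s)))))

    StepEdge-reflect : StepEdge d =[ reflect n c ]⇒ StepEdge d′
    StepEdge-reflect (forward s)  = backward (reflect-Step s)
    StepEdge-reflect (backward s) = forward (reflect-Step s)

  reflect-determines-steps : ∀ {d d′} c → Ascending d → Ascending d′ → StepEdge d =[ reflect n c ]⇒ StepEdge d′ →
                             ∀ k → k < 3 → d k ≈ d′ ((c + 2 * k + 2) % 3)
  reflect-determines-steps {d} {d′} c asc asc′ maps k k<3 =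
    +-cancelˡ-≈ (toℕ ry) (+-cancelʳ-≈ (toℕ x) (begin
      toℕ ry + d k + toℕ x           ≡⟨ solve 3 (λ a e b → a :+ e :+ b := a :+ (b :+ e)) refl (toℕ ry) (d k) (toℕ x) ⟩
      toℕ ry + (toℕ x + d k)         ≈⟨ +-congˡ (toℕ ry) (toℕ-⊕ x (d k)) ⟨
      toℕ ry + toℕ y                 ≈⟨ reflect-toℕ c y ⟩
      c                              ≈⟨ reflect-toℕ c x ⟨
      toℕ rx + toℕ x                 ≈⟨ +-congʳ (toℕ x) (≈-trans (≡⇒toℕ-≈ rx-step) (toℕ-⊕ ry (d′ (cls ry)))) ⟩
      toℕ ry + d′ (cls ry) + toℕ x   ≡⟨ cong (λ j → toℕ ry + d′ j + toℕ x) cls-ry ⟩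
      toℕ ry + d′ ((c + 2 * k + 2) % 3) + toℕ x ∎))
    where
    open ≈-Reasoning
    x  = vertex k
    y  = x ⊕ d k
    rx = reflect n c x
    ry = reflect n c y
    s = Step-vertex d k k<3
    cy≡cx+1 : cls y ≡ (cls x + 1) % 3
    cy≡cx+1 = cls-Step {d} asc s
    cls-ry : cls ry ≡ (c + 2 * k + 2) % 3
    cls-ry = trans (cls-reflect-succ c x y cy≡cx+1) (cong (λ j → (c + 2 * j + 2) % 3) (cls-vertex k k<3))
    rx-step : rx ≡ ry ⊕ d′ (cls ry)
    rx-step = StepEdge⇒Step {d′} asc′ (StepEdge-sym (maps (forward s))) (cls-reflect-pred c x y cy≡cx+1)

  -- Walks

  -- a polygon read as an n-periodic sequence of vertices
  record Walk : Set where
    field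
      at           : ℕ → Fin n
      at-cong      : ∀ {a b} → a ≈ b → at a ≡ at b
      at-injective : ∀ {a b} → at a ≡ at b → a ≈ b

  data WalkEdge (w : Walk) (x y : Fin n) : Set where
    along   : ∀ t → Walk.at w t ≡ x → Walk.at w (suc t) ≡ y → WalkEdge w x y
    against : ∀ t → Walk.at w t ≡ y → Walk.at w (suc t) ≡ x → WalkEdge w x y

  Traces : Polygon n → Walk → Set
  Traces (σ , _) w = ∀ i → σ i ≡ Walk.at w (toℕ i)

  toℕ-next : ∀ i → toℕ (next n i) ≈ suc (toℕ i)
  toℕ-next i = ≈-trans (toℕ-mod≈ (toℕ i + 1)) (≡⇒≈ (+-comm (toℕ i) 1))

  Edge⇔WalkEdge : ∀ P w → Traces P w → ∀ {x y} → Edge n P x y ⇔ WalkEdge w x y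
  Edge⇔WalkEdge P@(σ , _) w σ≡at = mk⇔ to from
    where
    open Walk w
    at-next : ∀ i → σ (next n i) ≡ at (suc (toℕ i))
    at-next i = trans (σ≡at (next n i)) (at-cong (toℕ-next i))
    at-mod : ∀ t → σ (t mod n) ≡ at t
    at-mod t = trans (σ≡at (t mod n)) (at-cong (toℕ-mod≈ t))
    at-next-mod : ∀ t → σ (next n (t mod n)) ≡ at (suc t)
    at-next-mod t = trans (at-next (t mod n)) (at-cong (+-congˡ 1 (toℕ-mod≈ t)))
    to : ∀ {x y} → Edge n P x y → WalkEdge w x y
    to (i , inj₁ (e₁ , e₂)) = along (toℕ i) (trans (sym (σ≡at i)) e₁) (trans (sym (at-next i)) e₂)
    to (i , inj₂ (e₁ , e₂)) = against (toℕ i) (trans (sym (σ≡at i)) e₁) (trans (sym (at-next i)) e₂)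
    from : ∀ {x y} → WalkEdge w x y → Edge n P x y
    from (along t e₁ e₂)   = t mod n , inj₁ (trans (at-mod t) e₁ , trans (at-next-mod t) e₂)
    from (against t e₁ e₂) = t mod n , inj₂ (trans (at-mod t) e₁ , trans (at-next-mod t) e₂)

  walkOf : Polygon n → Walk
  walkOf (σ , σ-injective) = record
    { at           = λ t → σ (t mod n)
    ; at-cong      = λ a≈b → cong σ (mod-cong a≈b)
    ; at-injective = λ eq → mod-injective (σ-injective eq)
    }

  walkOf-traces : ∀ P → Traces P (walkOf P)
  walkOf-traces (σ , _) i = cong σ (sym (toℕ-mod i))

  polygonOf : Walk → Polygon n
  polygonOf w = (λ i → at (toℕ i)) , (λ eq → toℕ-≈-injective (at-injective eq))
    where open Walk w

  polygonOf-traces : ∀ w → Traces (polygonOf w) w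
  polygonOf-traces w i = refl

  at-surjective : ∀ w x → ∃ λ t → Walk.at w t ≡ x
  at-surjective w x = from-index (injective⇒surjective (proj₁ (polygonOf w)) (proj₂ (polygonOf w)) x)
    where
    from-index : (∃ λ i → Walk.at w (toℕ i) ≡ x) → ∃ λ t → Walk.at w t ≡ x
    from-index (i , eq) = toℕ i , eq

  pred[n]*pred[n]*t≈t : ∀ t → pred n * (pred n * t) ≈ t
  pred[n]*pred[n]*t≈t t = +-cancelʳ-≈ (pred n * t) (begin
    pred n * (pred n * t) + pred n * t  ≡⟨ +-comm (pred n * (pred n * t)) (pred n * t) ⟩
    pred n * t + pred n * (pred n * t)  ≈⟨ m+pred[n]*m≈0 (pred n * t) ⟩
    0                                   ≈⟨ m+pred[n]*m≈0 t ⟨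
    t + pred n * t                      ∎)
    where open ≈-Reasoning

  suc[pred[n]*suc[t]]≈pred[n]*t : ∀ t → suc (pred n * suc t) ≈ pred n * t
  suc[pred[n]*suc[t]]≈pred[n]*t t = begin
    suc (pred n * suc t)      ≡⟨ cong suc (*-suc (pred n) t) ⟩
    suc (pred n + pred n * t) ≡⟨ cong (_+ pred n * t) (suc-pred n) ⟩
    n + pred n * t            ≡⟨ +-comm n (pred n * t) ⟩
    pred n * t + n            ≈⟨ m+n≈m (pred n * t) ⟩
    pred n * t                ∎
    where open ≈-Reasoning

  -- the same polygon walked backwards, started so that its first edge is the first edge of w
  reverse : Walk → Walk
  reverse w = record
    { at           = λ t → at (suc (pred n * t))
    ; at-cong      = λ a≈b → at-cong (+-congˡ 1 (*-cong (≈-refl {pred n}) a≈b))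
    ; at-injective = λ {a} {b} eq → injective (+-cancelˡ-≈ 1 (at-injective eq))
    }
    where
    open Walk w
    injective : ∀ {a b} → pred n * a ≈ pred n * b → a ≈ b
    injective {a} {b} ka≈kb = +-cancelʳ-≈ (pred n * a) (begin
      a + pred n * a  ≈⟨ m+pred[n]*m≈0 a ⟩
      0               ≈⟨ m+pred[n]*m≈0 b ⟨
      b + pred n * b  ≈⟨ +-congˡ b ka≈kb ⟨
      b + pred n * a  ∎)
      where open ≈-Reasoning

  reverse-edges : ∀ w {x y} → WalkEdge (reverse w) x y ⇔ WalkEdge w x y
  reverse-edges w = mk⇔ to from
    where
    open Walk w
    back : ∀ t → at (suc (pred n * suc t)) ≡ at (pred n * t)
    back t = at-cong (suc[pred[n]*suc[t]]≈pred[n]*t t)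
    to : ∀ {x y} → WalkEdge (reverse w) x y → WalkEdge w x y
    to (along t e₁ e₂)   = against (pred n * t) (trans (sym (back t)) e₂) e₁
    to (against t e₁ e₂) = along (pred n * t) (trans (sym (back t)) e₂) e₁
    ahead : ∀ t → at (suc (pred n * (pred n * t))) ≡ at (suc t)
    ahead t = at-cong (+-congˡ 1 (pred[n]*pred[n]*t≈t t))
    back-ahead : ∀ t → at (suc (pred n * suc (pred n * t))) ≡ at t
    back-ahead t = trans (back (pred n * t)) (at-cong (pred[n]*pred[n]*t≈t t))
    from : ∀ {x y} → WalkEdge w x y → WalkEdge (reverse w) x y
    from (along t e₁ e₂)   = against (pred n * t) (trans (ahead t) e₂) (trans (back-ahead t) e₁)
    from (against t e₁ e₂) = along (pred n * t) (trans (ahead t) e₂) (trans (back-ahead t) e₁)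

  reverse-at-0 : ∀ w → Walk.at (reverse w) 0 ≡ Walk.at w 1
  reverse-at-0 w = Walk.at-cong w (≡⇒≈ (cong suc (*-zeroʳ (pred n))))

  reverse-at-1 : ∀ w → Walk.at (reverse w) 1 ≡ Walk.at w 0
  reverse-at-1 w = Walk.at-cong w (≈-trans (≡⇒≈ (trans (cong suc (*-identityʳ (pred n))) (suc-pred n))) n≈0)

  module _ (P Q : Polygon n) {E E′ : Fin n → Fin n → Set}
           (P≐E : ∀ {x y} → Edge n P x y ⇔ E x y) (Q≐E′ : ∀ {x y} → Edge n Q x y ⇔ E′ x y) where

    mapsOnto : ∀ f → (∀ {x y} → E x y ⇔ E′ (f x) (f y)) → MapsOnto n f P Q
    mapsOnto f E≐E′ x y = ⇔-trans P≐E (⇔-trans E≐E′ (⇔-sym Q≐E′))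

    mapsOnto⇒ : ∀ f → MapsOnto n f P Q → E =[ f ]⇒ E′
    mapsOnto⇒ f maps e = Equivalence.to Q≐E′ (Equivalence.to (maps _ _) (Equivalence.from P≐E e))

  record ClassStepped (E : Fin n → Fin n → Set) : Set where
    field
      steps     : ℕ → ℕ
      ascending : Ascending steps
      edges     : ∀ {x y} → E x y ⇔ StepEdge steps x y
      total≉0   : ¬ (steps 0 + steps 1 + steps 2 ≈ 0)

  ClassStepped-transfer : ∀ {E E′} → (∀ {x y} → E x y ⇔ E′ x y) → ClassStepped E′ → ClassStepped E
  ClassStepped-transfer E≐E′ stepped = record
    { steps = steps ; ascending = ascending ; edges = ⇔-trans E≐E′ edges ; total≉0 = total≉0 }
    where open ClassStepped stepped

  stepping-walk-edges : ∀ w d → (∀ t → Step d (Walk.at w t) (Walk.at w (suc t))) →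
                        ∀ {x y} → WalkEdge w x y ⇔ StepEdge d x y
  stepping-walk-edges w d walk-Step = mk⇔ to from
    where
    open Walk w
    to : ∀ {x y} → WalkEdge w x y → StepEdge d x y
    to (along t refl refl)   = forward (walk-Step t)
    to (against t refl refl) = backward (walk-Step t)
    step-at : ∀ {x y} → Step d x y → ∃ λ t → at t ≡ x × at (suc t) ≡ y
    step-at {x} refl = step-from (at-surjective w x)
      where
      step-from : (∃ λ t → at t ≡ x) → ∃ λ t → at t ≡ x × at (suc t) ≡ x ⊕ d (cls x)
      step-from (t , refl) = t , refl , walk-Step t
    from : ∀ {x y} → StepEdge d x y → WalkEdge w x y
    from (forward s)  = let (t , e₁ , e₂) = step-at s in along t e₁ e₂
    from (backward s) = let (t , e₁ , e₂) = step-at s in against t e₁ e₂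

  module Mod-m = Congruence m

  3*-cancel-≈ : ∀ {a b} → 3 * a ≈ 3 * b → a Mod-m.≈ b
  3*-cancel-≈ {a} {b} (mk≈ 3a≈3b) = Mod-m.mk≈ (*-cancelʳ-≡ (a % m) (b % m) 3 (begin
    a % m * 3          ≡⟨ m%n*o≡m*o%[n*o] a m 3 ⟩
    a * 3 % (m * 3)    ≡⟨ cong (_% (m * 3)) (*-comm a 3) ⟩
    3 * a % (m * 3)    ≡⟨ %-congʳ (*-comm m 3) ⟩
    3 * a % n          ≡⟨ 3a≈3b ⟩
    3 * b % n          ≡⟨ %-congʳ (*-comm 3 m) ⟩
    3 * b % (m * 3)    ≡⟨ cong (_% (m * 3)) (*-comm 3 b) ⟩
    b * 3 % (m * 3)    ≡⟨ m%n*o≡m*o%[n*o] b m 3 ⟨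
    b % m * 3          ∎))
    where
    open ≡-Reasoning
    instance
      m*3-nonZero : NonZero (m * 3)
      m*3-nonZero = m*n≢0 m 3

-- The structure of circular polygons

module CircularWalks (p : ℕ) .{{_ : NonZero p}} (p-prime : Prime p) (3<p : 3 < p) where

  open Vertices p public

  0<p : 0 < p
  0<p = >-nonZero⁻¹ p

  p∤ : ∀ {i} → 1 ≤ i → i < p → ¬ (p ∣ i)
  p∤ 1≤i i<p p∣i = <⇒≢ 1≤i (sym (Mod-m.∣∧<⇒≡0 p∣i i<p))

  3*≈0⇒p∣ : ∀ {a} → 3 * a ≈ 0 → p ∣ a
  3*≈0⇒p∣ 3a≈0 = *-cancelˡ-∣ 3 (≈0⇒∣ 3a≈0)

  3*i≉0 : ∀ {i} → 1 ≤ i → i < p → ¬ (3 * i ≈ 0)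
  3*i≉0 1≤i i<p 3i≈0 = p∤ 1≤i i<p (3*≈0⇒p∣ 3i≈0)

  -- uses p ∤ 2, i.e. that p is odd
  3*i+3*i≉0 : ∀ {i} → 1 ≤ i → i < p → ¬ (3 * i + 3 * i ≈ 0)
  3*i+3*i≉0 {i} 1≤i i<p 6i≈0 =
    [ p∤ (s≤s z≤n) (<-trans (s≤s (s≤s (s≤s z≤n))) 3<p) , p∤ 1≤i i<p ]′
      (euclidsLemma 2 i p-prime (3*≈0⇒p∣ (subst (_≈ 0) 3i+3i≡3*[2*i] 6i≈0)))
    where
    3i+3i≡3*[2*i] : 3 * i + 3 * i ≡ 3 * (2 * i)
    3i+3i≡3*[2*i] = solve 1 (λ i → con 3 :* i :+ con 3 :* i := con 3 :* (con 2 :* i)) refl i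

  p*k≈0⇒3∣k : ∀ {k} → p * k ≈ 0 → 3 ∣ k
  p*k≈0⇒3∣k {k} pk≈0 = *-cancelˡ-∣ p (subst (_∣ p * k) (*-comm 3 p) (≈0⇒∣ pk≈0))

  ≤3⇒<n : ∀ {k} → k ≤ 3 → k < n
  ≤3⇒<n k≤3 = ≤-<-trans k≤3 (<-≤-trans 3<p (m≤n*m p 3))

  3∤ : ∀ {k} → 1 ≤ k → k < 3 → ¬ (3 ∣ k)
  3∤ 1≤k k<3 3∣k = <⇒≱ k<3 (∣⇒≤ {{>-nonZero 1≤k}} 3∣k)

  Symmetric : Walk → Set
  Symmetric w = ∀ i → 1 ≤ i → i < p → WalkEdge w =[ _⊕ 3 * i ]⇒ WalkEdge w

  module SymmetricWalk (w : Walk) (symmetric : Symmetric w) where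

    open Walk w

    c : ℕ → ℕ
    c t = cls (at t)

    at-≢ : ∀ k t → 1 ≤ k → k < n → at (k + t) ≢ at t
    at-≢ k t 1≤k k<n eq = <⇒≢ 1≤k (sym (≈⇒≡ k<n (>-nonZero⁻¹ n) (+-cancelʳ-≈ t (at-injective eq))))

    neighbours : ∀ {x y} t → WalkEdge w x y → x ≡ at (suc t) → y ≡ at (suc (suc t)) ⊎ y ≡ at t
    neighbours t (along _ e₁ e₂) x≡ = inj₁ (trans (sym e₂) (at-cong (+-congˡ 1 (at-injective (trans e₁ x≡)))))
    neighbours t (against _ e₁ e₂) x≡ = inj₂ (trans (sym e₁) (at-cong (+-cancelˡ-≈ 1 (at-injective (trans e₂ x≡)))))

    Shifted : ℕ → ℕ → ℕ → Set
    Shifted k δ t = at (k + t) ≡ at t ⊕ δ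

    module _ {δ} (invariant : WalkEdge w =[ _⊕ δ ]⇒ WalkEdge w) where

      -- the rotated image of the edge at t ends in a neighbour of at (suc k + t)
      shifted-successor : ∀ {k t} → Shifted (suc k) δ t → Shifted (suc k) δ (suc t) ⊎ at (suc t) ⊕ δ ≡ at (k + t)
      shifted-successor {k} {t} sh = map₁ (λ e → trans (cong (λ j → at (suc j)) (+-suc k t)) (sym e))
        (neighbours (k + t) (invariant (along t refl refl)) (sym sh))

      propagate : ∀ {k t} → Shifted k δ t → Shifted k δ (suc t) → ∀ j → Shifted k δ (j + t)
      propagate {k} {t} sh₀ sh₁ j = proj₁ (consecutive j)
        where
        step : ∀ {a} → Shifted k δ a → Shifted k δ (suc a) → Shifted k δ (suc (suc a))
        step {a} sh sh′ with neighbours (k + a) (invariant (along (suc a) refl refl)) (trans (sym sh′) (cong at (+-suc k a)))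
        ... | inj₁ e = trans (cong at (trans (+-suc k (suc a)) (cong suc (+-suc k a)))) (sym e)
        ... | inj₂ e = ⊥-elim (at-≢ 2 a (s≤s z≤n) (≤3⇒<n (n≤1+n 2))
                                 (⊕-cancelʳ δ (trans e sh)))
        consecutive : ∀ j → Shifted k δ (j + t) × Shifted k δ (suc (j + t))
        consecutive zero    = sh₀ , sh₁
        consecutive (suc j) = proj₂ (consecutive j) , step (proj₁ (consecutive j)) (proj₂ (consecutive j))

    iterate : ∀ {k δ t} → (∀ j → Shifted k δ (j + t)) → ∀ q → at (q * k + t) ≡ at t ⊕ q * δ
    iterate {k} {δ} {t} sh zero    = sym (⊕-identityʳ (at t))
    iterate {k} {δ} {t} sh (suc q) = begin
      at (k + q * k + t)    ≡⟨ cong at (+-assoc k (q * k) t) ⟩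
      at (k + (q * k + t))  ≡⟨ sh (q * k) ⟩
      at (q * k + t) ⊕ δ    ≡⟨ cong (_⊕ δ) (iterate sh q) ⟩
      at t ⊕ q * δ ⊕ δ      ≡⟨ ⊕-assoc (at t) (q * δ) δ ⟩
      at t ⊕ (q * δ + δ)    ≡⟨ cong (at t ⊕_) (+-comm (q * δ) δ) ⟩
      at t ⊕ (δ + q * δ)    ∎
      where open ≡-Reasoning

    -- after p repetitions the shift 3 * i has gone once around the n-gon
    propagating-shift⇒3∣ : ∀ {i k t} → (∀ j → Shifted k (3 * i) (j + t)) → 3 ∣ k
    propagating-shift⇒3∣ {i} {k} {t} sh = p*k≈0⇒3∣k (+-cancelʳ-≈ t (at-injective (begin
      at (p * k + t)       ≡⟨ iterate sh p ⟩
      at t ⊕ p * (3 * i)   ≡⟨ ⊕-congˡ (at t) p*3i≈0 ⟩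
      at t ⊕ 0             ≡⟨ ⊕-identityʳ (at t) ⟩
      at t                 ∎)))
      where
      open ≡-Reasoning
      p*3i≈0 : p * (3 * i) ≈ 0
      p*3i≈0 = ≈-trans (≡⇒≈ (solve 2 (λ p i → p :* (con 3 :* i) := i :* (con 3 :* p)) refl p i)) (m*n≈0 i)

    cls-consecutive-≢ : ∀ t → c t ≢ c (suc t)
    cls-consecutive-≢ t eq =
      impossible (same-cls⇒⊕3* (at t) (at (suc t)) eq (λ e → at-≢ 1 t ≤-refl (≤3⇒<n (s≤s z≤n)) (sym e)))
      where
      impossible : (∃ λ i → 1 ≤ i × i < p × Shifted 1 (3 * i) t) → ⊥
      impossible (i , 1≤i , i<p , sh) = [ returns-after-p , doubles ]′ (shifted-successor invariant {0} {t} sh)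
        where
        invariant = symmetric i 1≤i i<p
        returns-after-p : Shifted 1 (3 * i) (suc t) → ⊥
        returns-after-p sh′ = 3∤ ≤-refl (s≤s (s≤s z≤n)) (propagating-shift⇒3∣ {i} (propagate invariant sh sh′))
        doubles : at (suc t) ⊕ 3 * i ≡ at t → ⊥
        doubles e = 3*i+3*i≉0 1≤i i<p (⊕-fixed⇒≈0 (at t) (begin
          at t ⊕ (3 * i + 3 * i)   ≡⟨ ⊕-assoc (at t) (3 * i) (3 * i) ⟨
          at t ⊕ 3 * i ⊕ 3 * i     ≡⟨ cong (_⊕ 3 * i) sh ⟨
          at (suc t) ⊕ 3 * i       ≡⟨ e ⟩
          at t                     ∎))
          where open ≡-Reasoning

    cls-alternate-≢ : ∀ t → c t ≢ c (suc (suc t))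
    cls-alternate-≢ t eq =
      impossible (same-cls⇒⊕3* (at t) (at (suc (suc t))) eq (λ e → at-≢ 2 t (s≤s z≤n) (≤3⇒<n (n≤1+n 2)) (sym e)))
      where
      impossible : (∃ λ i → 1 ≤ i × i < p × Shifted 2 (3 * i) t) → ⊥
      impossible (i , 1≤i , i<p , sh) = [ returns-after-p , fixes ]′ (shifted-successor invariant {1} {t} sh)
        where
        invariant = symmetric i 1≤i i<p
        returns-after-p : Shifted 2 (3 * i) (suc t) → ⊥
        returns-after-p sh′ = 3∤ (s≤s z≤n) ≤-refl (propagating-shift⇒3∣ {i} (propagate invariant sh sh′))
        fixes : at (suc t) ⊕ 3 * i ≡ at (suc t) → ⊥
        fixes e = 3*i≉0 1≤i i<p (⊕-fixed⇒≈0 (at (suc t)) e)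

    ascending : c 1 ≡ (c 0 + 1) % 3 → ∀ t → c (suc t) ≡ (c t + 1) % 3
    ascending asc₀ zero    = asc₀
    ascending asc₀ (suc t) = trans
      (third-residue (cls<3 (at t)) (cls<3 (at (suc (suc t))))
        (λ e → cls-alternate-≢ t (sym e))
        (λ e → cls-consecutive-≢ (suc t) (trans (ascending asc₀ t) (sym e))))
      (cong (λ j → (j + 1) % 3) (sym (ascending asc₀ t)))

    module AscendingWalk (asc₀ : c 1 ≡ (c 0 + 1) % 3) where

      cls-at : ∀ t → c t ≡ (c 0 + t) % 3
      cls-at zero    = sym (trans (cong (_% 3) (+-identityʳ (c 0))) (m%n%n≡m%n (toℕ (at 0)) 3))
      cls-at (suc t) = Mod3.≈⇒%≡ (begin
        toℕ (at (suc t))  ≈⟨ Mod3.mk≈ (ascending asc₀ t) ⟩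
        c t + 1           ≈⟨ Mod3.+-congʳ 1 (Mod3.mk≈ (trans (m%n%n≡m%n (toℕ (at t)) 3) (cls-at t))) ⟩
        c 0 + t + 1       ≡⟨ trans (+-assoc (c 0) t 1) (cong (c 0 +_) (+-comm t 1)) ⟩
        c 0 + suc t       ∎)
        where open Mod3.≈-Reasoning

      c0≡c3 : c 0 ≡ c 3
      c0≡c3 = sym (trans (cls-at 3) (trans ([m+n]%n≡m%n (c 0) 3) (m%n%n≡m%n (toℕ (at 0)) 3)))

      period : ∃ λ i → 1 ≤ i × i < p × ∀ t → Shifted 3 (3 * i) t
      period = extend (same-cls⇒⊕3* (at 0) (at 3) c0≡c3 (λ e → at-≢ 3 0 (s≤s z≤n) (≤3⇒<n ≤-refl) (sym e)))
        where
        extend : (∃ λ i → 1 ≤ i × i < p × Shifted 3 (3 * i) 0) → ∃ λ i → 1 ≤ i × i < p × ∀ t → Shifted 3 (3 * i) t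
        extend (i , 1≤i , i<p , sh) = i , 1≤i , i<p , [ everywhere , impossible ]′ (shifted-successor invariant {2} {0} sh)
          where
          invariant = symmetric i 1≤i i<p
          everywhere : Shifted 3 (3 * i) 1 → ∀ t → Shifted 3 (3 * i) t
          everywhere sh′ t = subst (Shifted 3 (3 * i)) (+-identityʳ t) (propagate invariant {3} {0} sh sh′ t)
          impossible : at 1 ⊕ 3 * i ≡ at 2 → ∀ t → Shifted 3 (3 * i) t
          impossible e = ⊥-elim (cls-consecutive-≢ 1 (trans (sym (cls-⊕-3* (at 1) i)) (cong cls e)))

    module PeriodicWalk (asc₀ : c 1 ≡ (c 0 + 1) % 3) {i} (1≤i : 1 ≤ i) (i<p : i < p)
                         (shifted : ∀ t → Shifted 3 (3 * i) t) where

      open AscendingWalk asc₀ using (cls-at)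

      u : ℕ → ℕ
      u t = at (suc t) ⊖ at t

      at-suc : ∀ t → at (suc t) ≡ at t ⊕ u t
      at-suc t = sym (⊕-⊖ (at t) (at (suc t)))

      at-suc-periodic : ∀ t → at (suc t) ≡ at t ⊕ u (t % 3)
      at-suc-periodic = induction₃ (λ t → at (suc t) ≡ at t ⊕ u (t % 3)) (at-suc 0) (at-suc 1) (at-suc 2) λ t eq → begin
        at (3 + suc t)               ≡⟨ shifted (suc t) ⟩
        at (suc t) ⊕ 3 * i           ≡⟨ cong (_⊕ 3 * i) eq ⟩
        at t ⊕ u (t % 3) ⊕ 3 * i     ≡⟨ ⊕-comm (at t) (u (t % 3)) (3 * i) ⟩
        at t ⊕ 3 * i ⊕ u (t % 3)     ≡⟨ cong (_⊕ u (t % 3)) (shifted t) ⟨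
        at (3 + t) ⊕ u (t % 3)       ∎
        where open ≡-Reasoning

      u-ascending : ∀ t → u t % 3 ≡ 1
      u-ascending t = Mod3.≈⇒%≡ (Mod3.+-cancelˡ-≈ (c t) (Mod3.mk≈ (begin
        (c t + u t) % 3       ≡⟨ cls-⊕ (at t) (u t) ⟨
        cls (at t ⊕ u t)      ≡⟨ cong cls (at-suc t) ⟨
        c (suc t)             ≡⟨ ascending asc₀ t ⟩
        (c t + 1) % 3         ∎)))
        where open ≡-Reasoning

      -- the step out of class k is the step taken at the position t < 3 of the walk where c t ≡ k
      r : ℕ
      r = (2 * c 0) % 3

      steps : ℕ → ℕ
      steps k = u ((k + r) % 3)

      steps-cls : ∀ t → (c t + r) % 3 ≡ t % 3
      steps-cls t = Mod3.≈⇒%≡ (begin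
        c t + r                  ≈⟨ Mod3.+-cong ct≈c0+t (Mod3.m%n≈m (2 * c 0)) ⟩
        c 0 + t + 2 * c 0        ≡⟨ solve 2 (λ a t → a :+ t :+ con 2 :* a := t :+ a :* con 3) refl (c 0) t ⟩
        t + c 0 * 3              ≈⟨ Mod3.+-congˡ t (Mod3.m*n≈0 (c 0)) ⟩
        t + 0                    ≡⟨ +-identityʳ t ⟩
        t                        ∎)
        where
        open Mod3.≈-Reasoning
        ct≈c0+t : c t Mod3.≈ c 0 + t
        ct≈c0+t = Mod3.mk≈ (trans (m%n%n≡m%n (toℕ (at t)) 3) (cls-at t))

      walk-Step : ∀ t → Step steps (at t) (at (suc t))
      walk-Step t = trans (at-suc-periodic t) (cong (λ j → at t ⊕ u j) (sym (steps-cls t)))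

      edges : ∀ {x y} → WalkEdge w x y ⇔ StepEdge steps x y
      edges = stepping-walk-edges w steps walk-Step

      at-3 : at 3 ≡ at 0 ⊕ (u 0 + u 1 + u 2)
      at-3 = begin
        at 3                      ≡⟨ at-suc 2 ⟩
        at 2 ⊕ u 2                ≡⟨ cong (_⊕ u 2) (at-suc 1) ⟩
        at 1 ⊕ u 1 ⊕ u 2          ≡⟨ cong (λ x → x ⊕ u 1 ⊕ u 2) (at-suc 0) ⟩
        at 0 ⊕ u 0 ⊕ u 1 ⊕ u 2    ≡⟨ cong (_⊕ u 2) (⊕-assoc (at 0) (u 0) (u 1)) ⟩
        at 0 ⊕ (u 0 + u 1) ⊕ u 2  ≡⟨ ⊕-assoc (at 0) (u 0 + u 1) (u 2) ⟩
        at 0 ⊕ (u 0 + u 1 + u 2)  ∎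
        where open ≡-Reasoning

      total≉0 : ¬ (steps 0 + steps 1 + steps 2 ≈ 0)
      total≉0 total≈0 = 3*i≉0 1≤i i<p (begin
        3 * i                        ≈⟨ ⊕-cancelˡ (at 0) (trans (sym (shifted 0)) at-3) ⟩
        u 0 + u 1 + u 2              ≡⟨ sum-rotate₃ u r (m%n<n (2 * c 0) 3) ⟨
        steps 0 + steps 1 + steps 2  ≈⟨ total≈0 ⟩
        0                            ∎)
        where open ≈-Reasoning

      classStepped : ClassStepped (WalkEdge w)
      classStepped = record
        { steps = steps ; ascending = λ k _ → u-ascending ((k + r) % 3) ; edges = edges ; total≉0 = total≉0 }

    ascending-classStepped : c 1 ≡ (c 0 + 1) % 3 → ClassStepped (WalkEdge w)
    ascending-classStepped asc₀ = from-period (AscendingWalk.period asc₀)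
      where
      from-period : (∃ λ i → 1 ≤ i × i < p × ∀ t → Shifted 3 (3 * i) t) → ClassStepped (WalkEdge w)
      from-period (i , 1≤i , i<p , shifted) = PeriodicWalk.classStepped asc₀ 1≤i i<p shifted

  symmetric-classStepped : ∀ w → Symmetric w → ClassStepped (WalkEdge w)
  symmetric-classStepped w symmetric =
    [ ascending-classStepped , descending ]′ (cyclic-order (cls<3 (at 0)) (cls<3 (at 1)) (cls-consecutive-≢ 0))
    where
    open Walk w
    open SymmetricWalk w symmetric using (cls-consecutive-≢; ascending-classStepped)
    reversed-symmetric : Symmetric (reverse w)
    reversed-symmetric i 1≤i i<p e =
      Equivalence.from (reverse-edges w) (symmetric i 1≤i i<p (Equivalence.to (reverse-edges w) e))
    descending : cls (at 0) ≡ (cls (at 1) + 1) % 3 → ClassStepped (WalkEdge w)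
    descending desc₀ = ClassStepped-transfer (⇔-sym (reverse-edges w))
      (SymmetricWalk.ascending-classStepped (reverse w) reversed-symmetric
        (trans (cong cls (reverse-at-1 w)) (trans desc₀ (cong (λ x → (cls x + 1) % 3) (sym (reverse-at-0 w))))))

  circular⇒ClassStepped : ∀ P → Circular p P → ClassStepped (Edge n P)
  circular⇒ClassStepped P (_ , rotations) =
    ClassStepped-transfer P≐w (symmetric-classStepped (walkOf P) symmetric)
    where
    P≐w : ∀ {x y} → Edge n P x y ⇔ WalkEdge (walkOf P) x y
    P≐w = Edge⇔WalkEdge P (walkOf P) (walkOf-traces P)
    symmetric : Symmetric (walkOf P)
    symmetric i 1≤i i<p = mapsOnto⇒ P P P≐w P≐w (_⊕ 3 * i) (rotations i 1≤i (<⇒≤ i<p))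

-- Canonical polygons and their equivalences

module Classification (p : ℕ) .{{_ : NonZero p}} (p-prime : Prime p) (3<p : 3 < p) where

  open CircularWalks p p-prime 3<p public
  module Mod-p = PrimeModulus p p-prime

  stepsOf : ℕ → ℕ → ℕ → ℕ → ℕ
  stepsOf a b c 0             = 3 * a + 1
  stepsOf a b c 1             = 3 * b + 1
  stepsOf a b c (suc (suc _)) = 3 * c + 1

  [3*x+1]%3≡1 : ∀ x → (3 * x + 1) % 3 ≡ 1
  [3*x+1]%3≡1 x = trans (cong (_% 3) (trans (+-comm (3 * x) 1) (cong (1 +_) (*-comm 3 x)))) ([m+kn]%n≡m%n 1 x 3)

  stepsOf-ascending : ∀ a b c → Ascending (stepsOf a b c)
  stepsOf-ascending a b c 0 _             = [3*x+1]%3≡1 a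
  stepsOf-ascending a b c 1 _             = [3*x+1]%3≡1 b
  stepsOf-ascending a b c (suc (suc _)) _ = [3*x+1]%3≡1 c

  -- the walk that starts at vertex 0 and steps by 3a+1, 3b+1, 3c+1 in turn
  module CanonicalWalk (a b c : ℕ) where

    d : ℕ → ℕ
    d = stepsOf a b c

    S W : ℕ
    S = a + b + c + 1
    W = d 0 + d 1 + d 2

    W≡S*3 : W ≡ S * 3
    W≡S*3 = solve 3 (λ a b c → con 3 :* a :+ con 1 :+ (con 3 :* b :+ con 1) :+ (con 3 :* c :+ con 1)
                               := (a :+ b :+ c :+ con 1) :* con 3) refl a b c

    offset : ℕ → ℕ
    offset 0             = 0
    offset 1             = d 0
    offset (suc (suc _)) = d 0 + d 1

    position : ℕ → ℕ
    position t = t / 3 * W + offset (t % 3)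

    position-+*3 : ∀ t k → position (t + k * 3) ≡ position t + k * W
    position-+*3 t k = begin
      (t + k * 3) / 3 * W + offset ((t + k * 3) % 3)  ≡⟨ cong₂ (λ q r → q * W + offset r) t+3k/3 ([m+kn]%n≡m%n t k 3) ⟩
      (t / 3 + k) * W + offset (t % 3)
        ≡⟨ solve 4 (λ q k w r → (q :+ k) :* w :+ r := q :* w :+ r :+ k :* w) refl (t / 3) k W (offset (t % 3)) ⟩
      t / 3 * W + offset (t % 3) + k * W              ∎
      where
      open ≡-Reasoning
      t+3k/3 : (t + k * 3) / 3 ≡ t / 3 + k
      t+3k/3 = trans (+-distrib-/-∣ʳ t (divides k refl)) (cong (t / 3 +_) (m*n/n≡m k 3))

    position-suc : ∀ t → position (suc t) ≡ position t + d (t % 3)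
    position-suc t = begin
      position (suc t)              ≡⟨ cong (λ v → position (suc v)) t≡r+q*3 ⟩
      position (suc r + q * 3)      ≡⟨ position-+*3 (suc r) q ⟩
      position (suc r) + q * W      ≡⟨ cong (_+ q * W) (first-round r (m%n<n t 3)) ⟩
      position r + d r + q * W      ≡⟨ solve 3 (λ a b c → a :+ b :+ c := a :+ c :+ b) refl (position r) (d r) (q * W) ⟩
      position r + q * W + d r      ≡⟨ cong (_+ d r) (position-+*3 r q) ⟨
      position (r + q * 3) + d r    ≡⟨ cong (λ v → position v + d r) t≡r+q*3 ⟨
      position t + d r              ∎
      where
      open ≡-Reasoning
      r = t % 3
      q = t / 3
      t≡r+q*3 : t ≡ r + q * 3
      t≡r+q*3 = m≡m%n+[m/n]*n t 3
      first-round : ∀ r → r < 3 → position (suc r) ≡ position r + d r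
      first-round 0 _ = refl
      first-round 1 _ = refl
      first-round 2 _ = trans (+-identityʳ _) (+-identityʳ _)
      first-round (suc (suc (suc _))) (s≤s (s≤s (s≤s ())))

    position-mod3 : ∀ t → position t % 3 ≡ t % 3
    position-mod3 t = begin
      (t / 3 * W + offset r) % 3            ≡⟨ cong (λ w → (t / 3 * w + offset r) % 3) W≡S*3 ⟩
      (t / 3 * (S * 3) + offset r) % 3
        ≡⟨ cong (_% 3) (solve 3 (λ q s o → q :* (s :* con 3) :+ o := o :+ q :* s :* con 3) refl (t / 3) S (offset r)) ⟩
      (offset r + t / 3 * S * 3) % 3        ≡⟨ [m+kn]%n≡m%n (offset r) (t / 3 * S) 3 ⟩
      offset r % 3                          ≡⟨ offset-mod3 r (m%n<n t 3) ⟩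
      r                                     ∎
      where
      open ≡-Reasoning
      r = t % 3
      offset-mod3 : ∀ r → r < 3 → offset r % 3 ≡ r
      offset-mod3 0 _ = refl
      offset-mod3 1 _ = [3*x+1]%3≡1 a
      offset-mod3 2 _ = trans (cong (_% 3) (solve 2 (λ a b → con 3 :* a :+ con 1 :+ (con 3 :* b :+ con 1)
                                                        := con 2 :+ (a :+ b) :* con 3) refl a b))
                              ([m+kn]%n≡m%n 2 (a + b) 3)
      offset-mod3 (suc (suc (suc _))) (s≤s (s≤s (s≤s ())))

    position-mod : ∀ t → position (t % n) ≈ position t
    position-mod t = begin
      position (t % n)                ≡⟨ +-identityʳ _ ⟨
      position (t % n) + 0            ≈⟨ +-congˡ (position (t % n)) (m*n≈0 (t / n * S)) ⟨
      position (t % n) + t / n * S * n ≡⟨ cong (position (t % n) +_) kW≡ ⟨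
      position (t % n) + k * W        ≡⟨ position-+*3 (t % n) k ⟨
      position (t % n + k * 3)        ≡⟨ cong position t≡ ⟨
      position t                      ∎
      where
      open ≈-Reasoning
      k = t / n * p
      t≡ : t ≡ t % n + k * 3
      t≡ = trans (m≡m%n+[m/n]*n t n) (cong (t % n +_) (solve 2 (λ q p → q :* (con 3 :* p) := q :* p :* con 3) refl (t / n) p))
      kW≡ : k * W ≡ t / n * S * n
      kW≡ = trans (cong (k *_) W≡S*3) (solve 3 (λ q p s → q :* p :* (s :* con 3) := q :* s :* (con 3 :* p)) refl (t / n) p S)

    position-cong : ∀ {x y} → x ≈ y → position x ≈ position y
    position-cong {x} {y} (mk≈ x%n≡y%n) =
      ≈-trans (≈-sym (position-mod x)) (≈-trans (≡⇒≈ (cong position x%n≡y%n)) (position-mod y))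

    module _ (a<p : a < p) (b<p : b < p) (c<p : c < p) (p∤S : ¬ (p ∣ S)) where

      position-injective : ∀ {x y} → x < n → y < n → position x ≈ position y → x ≡ y
      position-injective {x} {y} x<n y<n eq = begin
        x                  ≡⟨ m≡m%n+[m/n]*n x 3 ⟩
        x % 3 + x / 3 * 3  ≡⟨ cong₂ (λ r q → r + q * 3) r≡ q≡ ⟩
        y % 3 + y / 3 * 3  ≡⟨ m≡m%n+[m/n]*n y 3 ⟨
        y                  ∎
        where
        open ≡-Reasoning
        r≡ : x % 3 ≡ y % 3
        r≡ = trans (sym (position-mod3 x)) (trans (Mod3.≈⇒%≡ (≈⇒≈₃ eq)) (position-mod3 y))
        qW≈ : x / 3 * W ≈ y / 3 * W
        qW≈ = +-cancelʳ-≈ (offset (x % 3)) (≈-trans eq (≡⇒≈ (cong (λ r → y / 3 * W + offset r) (sym r≡))))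
        *W≡3*[*S] : ∀ q → q * W ≡ 3 * (q * S)
        *W≡3*[*S] q = trans (cong (q *_) W≡S*3) (solve 2 (λ q s → q :* (s :* con 3) := con 3 :* (q :* s)) refl q S)
        /3<p : ∀ {z} → z < n → z / 3 < p
        /3<p {z} z<n = m<n*o⇒m/o<n (subst (z <_) (*-comm 3 p) z<n)
        q≡ : x / 3 ≡ y / 3
        q≡ = Mod-p.*-cancelʳ-≈ p∤S (/3<p x<n) (/3<p y<n)
               (3*-cancel-≈ (subst₂ _≈_ (*W≡3*[*S] (x / 3)) (*W≡3*[*S] (y / 3)) qW≈))

      walk : Walk
      walk = record
        { at           = λ t → position t mod n
        ; at-cong      = λ x≈y → mod-cong (position-cong x≈y)
        ; at-injective = λ {x} {y} eq → mk≈ (position-injective (m%n<n x n) (m%n<n y n)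
            (≈-trans (position-mod x) (≈-trans (mod-injective eq) (≈-sym (position-mod y)))))
        }

      walk-Step : ∀ t → Step d (Walk.at walk t) (Walk.at walk (suc t))
      walk-Step t = toℕ-≈-injective (begin
        toℕ (position (suc t) mod n)  ≈⟨ toℕ-mod≈ (position (suc t)) ⟩
        position (suc t)              ≡⟨ position-suc t ⟩
        position t + d (t % 3)        ≡⟨ cong (λ r → position t + d r) cls-x ⟨
        position t + d (cls x)        ≈⟨ +-congʳ (d (cls x)) (toℕ-mod≈ (position t)) ⟨
        toℕ x + d (cls x)             ≈⟨ toℕ-⊕ x (d (cls x)) ⟨
        toℕ (x ⊕ d (cls x))           ∎)
        where
        open ≈-Reasoning
        x = position t mod n
        cls-x : cls x ≡ t % 3
        cls-x = trans (Mod3.≈⇒%≡ (≈⇒≈₃ (toℕ-mod≈ (position t)))) (position-mod3 t)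

  Valid : ℕ → ℕ → ℕ → Set
  Valid a b c = (a < p × b < p × c < p) × (a ≢ b × b ≢ c × a ≢ c) × ¬ (p ∣ a + b + c + 1)

  canonical : ∀ a b c → Valid a b c → Polygon n
  canonical a b c ((a<p , b<p , c<p) , _ , p∤S) = polygonOf (CanonicalWalk.walk a b c a<p b<p c<p p∤S)

  canonical-edges : ∀ a b c (v : Valid a b c) → ∀ {x y} → Edge n (canonical a b c v) x y ⇔ StepEdge (stepsOf a b c) x y
  canonical-edges a b c ((a<p , b<p , c<p) , _ , p∤S) =
    ⇔-trans (Edge⇔WalkEdge (polygonOf w) w (polygonOf-traces w))
            (stepping-walk-edges w (stepsOf a b c) (walk-Step a<p b<p c<p p∤S))
    where
    open CanonicalWalk a b c using (walk; walk-Step)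
    w = walk a<p b<p c<p p∤S

  3*x+1-injective : ∀ {x y} → x < p → y < p → 3 * x + 1 ≈ 3 * y + 1 → x ≡ y
  3*x+1-injective {x} {y} x<p y<p eq =
    *-cancelˡ-≡ x y 3 (+-cancelʳ-≡ 1 (3 * x) (3 * y) (≈⇒≡ (3*z+1<n x<p) (3*z+1<n y<p) eq))
    where
    3*z+1<n : ∀ {z} → z < p → 3 * z + 1 < n
    3*z+1<n {z} z<p = ≤-trans (m≤m+n (suc (3 * z + 1)) 1)
      (≤-trans (≤-reflexive (solve 1 (λ z → con 1 :+ (con 3 :* z :+ con 1) :+ con 1 := con 3 :* (con 1 :+ z)) refl z))
               (*-monoʳ-≤ 3 z<p))

  +-%3-residue : ∀ k γ → (k + γ) % 3 ≡ (k + γ % 3) % 3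
  +-%3-residue k γ = sym (Mod3.≈⇒%≡ (Mod3.+-congˡ k (Mod3.m%n≈m γ)))

  reflect-%3-residue : ∀ γ k → (γ + 2 * k + 2) % 3 ≡ (γ % 3 + 2 * k + 2) % 3
  reflect-%3-residue γ k = sym (Mod3.≈⇒%≡ (Mod3.+-congʳ 2 (Mod3.+-congʳ (2 * k) (Mod3.m%n≈m γ))))

  canonical-circular : ∀ a b c (v : Valid a b c) → Circular p (canonical a b c v)
  canonical-circular a b c v@((a<p , b<p , c<p) , (a≢b , b≢c , a≢c) , _) = no-axis , rotations
    where
    P = canonical a b c v
    d = stepsOf a b c
    asc = stepsOf-ascending a b c
    edges : ∀ {x y} → Edge n P x y ⇔ StepEdge d x y
    edges = canonical-edges a b c v
    rotations : ∀ i → 1 ≤ i → i ≤ p → MapsOnto n (rot n (3 * i)) P P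
    rotations i _ _ = mapsOnto P P edges edges (_⊕ 3 * i)
                        (StepEdge-⊕ (3 * i) λ k k<3 → ≡⇒≈ (cong d (sym (k+3i%3≡k k k<3))))
      where
      k+3i%3≡k : ∀ k → k < 3 → (k + 3 * i) % 3 ≡ k
      k+3i%3≡k k k<3 = trans (cong (λ j → (k + j) % 3) (*-comm 3 i)) (trans ([m+kn]%n≡m%n k i 3) (m<n⇒m%n≡m k<3))
    no-axis : ¬ HasSymmetryAxis n P
    no-axis (γ , maps) = by-residue (γ % 3) (m%n<n γ 3)
      λ k k<3 → ≈-trans (symmetric k k<3) (≡⇒≈ (cong d (reflect-%3-residue γ k)))
      where
      symmetric = reflect-determines-steps γ asc asc (mapsOnto⇒ P P edges edges (reflect n γ) maps)
      -- the reflection fixes one class and swaps the other two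
      by-residue : ∀ r → r < 3 → (∀ k → k < 3 → d k ≈ d ((r + 2 * k + 2) % 3)) → ⊥
      by-residue 0 _ h = a≢c (3*x+1-injective a<p c<p (h 0 (s≤s z≤n)))
      by-residue 1 _ h = b≢c (3*x+1-injective b<p c<p (h 1 (s≤s (s≤s z≤n))))
      by-residue 2 _ h = a≢b (3*x+1-injective a<p b<p (h 0 (s≤s z≤n)))
      by-residue (suc (suc (suc _))) (s≤s (s≤s (s≤s ()))) _

  equivalent-by-steps : ∀ P Q {d d′} γ → (∀ {x y} → Edge n P x y ⇔ StepEdge d x y) → (∀ {x y} → Edge n Q x y ⇔ StepEdge d′ x y) →
                        (∀ k → k < 3 → d k ≈ d′ ((k + γ) % 3)) → Equivalent n P Q
  equivalent-by-steps P Q γ P≐ Q≐ d≈d′ = γ , mapsOnto P Q P≐ Q≐ (_⊕ γ) (StepEdge-⊕ γ d≈d′)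

  Rotated : ℕ → ℕ → ℕ → ℕ → ℕ → ℕ → Set
  Rotated a b c a′ b′ c′ = (a′ , b′ , c′) ≡ (a , b , c) ⊎ (a′ , b′ , c′) ≡ (b , c , a) ⊎ (a′ , b′ , c′) ≡ (c , a , b)

  rotated-steps : ∀ {a b c a′ b′ c′} → Rotated a b c a′ b′ c′ →
                  ∃ λ γ → ∀ k → k < 3 → stepsOf a b c k ≡ stepsOf a′ b′ c′ ((k + γ) % 3)
  rotated-steps {a} {b} {c} (inj₁ refl) = 0 , by-0
    where
    by-0 : ∀ k → k < 3 → stepsOf a b c k ≡ stepsOf a b c ((k + 0) % 3)
    by-0 0 _ = refl
    by-0 1 _ = refl
    by-0 2 _ = refl
    by-0 (suc (suc (suc _))) (s≤s (s≤s (s≤s ())))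
  rotated-steps {a} {b} {c} (inj₂ (inj₁ refl)) = 2 , by-2
    where
    by-2 : ∀ k → k < 3 → stepsOf a b c k ≡ stepsOf b c a ((k + 2) % 3)
    by-2 0 _ = refl
    by-2 1 _ = refl
    by-2 2 _ = refl
    by-2 (suc (suc (suc _))) (s≤s (s≤s (s≤s ())))
  rotated-steps {a} {b} {c} (inj₂ (inj₂ refl)) = 1 , by-1
    where
    by-1 : ∀ k → k < 3 → stepsOf a b c k ≡ stepsOf c a b ((k + 1) % 3)
    by-1 0 _ = refl
    by-1 1 _ = refl
    by-1 2 _ = refl
    by-1 (suc (suc (suc _))) (s≤s (s≤s (s≤s ())))

  equivalent⇒rotated : ∀ {a b c a′ b′ c′} (v : Valid a b c) (v′ : Valid a′ b′ c′) →
                       Equivalent n (canonical a b c v) (canonical a′ b′ c′ v′) → Rotated a b c a′ b′ c′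
  equivalent⇒rotated {a} {b} {c} {a′} {b′} {c′} v@((a<p , b<p , c<p) , _) v′@((a′<p , b′<p , c′<p) , _) (γ , maps) =
    by-residue (γ % 3) (m%n<n γ 3) λ k k<3 → ≈-trans (determined k k<3) (≡⇒≈ (cong (stepsOf a′ b′ c′) (+-%3-residue k γ)))
    where
    determined = ⊕-determines-steps γ (stepsOf-ascending a b c) (stepsOf-ascending a′ b′ c′)
      (mapsOnto⇒ (canonical a b c v) (canonical a′ b′ c′ v′) (canonical-edges a b c v) (canonical-edges a′ b′ c′ v′)
                 (_⊕ γ) maps)
    by-residue : ∀ r → r < 3 → (∀ k → k < 3 → stepsOf a b c k ≈ stepsOf a′ b′ c′ ((k + r) % 3)) → Rotated a b c a′ b′ c′
    by-residue 0 _ h = inj₁ (cong₂ _,_ (sym (3*x+1-injective a<p a′<p (h 0 (s≤s z≤n))))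
      (cong₂ _,_ (sym (3*x+1-injective b<p b′<p (h 1 (s≤s (s≤s z≤n))))) (sym (3*x+1-injective c<p c′<p (h 2 ≤-refl)))))
    by-residue 1 _ h = inj₂ (inj₂ (cong₂ _,_ (sym (3*x+1-injective c<p a′<p (h 2 ≤-refl)))
      (cong₂ _,_ (sym (3*x+1-injective a<p b′<p (h 0 (s≤s z≤n)))) (sym (3*x+1-injective b<p c′<p (h 1 (s≤s (s≤s z≤n))))))))
    by-residue 2 _ h = inj₂ (inj₁ (cong₂ _,_ (sym (3*x+1-injective b<p a′<p (h 1 (s≤s (s≤s z≤n)))))
      (cong₂ _,_ (sym (3*x+1-injective c<p b′<p (h 2 ≤-refl))) (sym (3*x+1-injective a<p c′<p (h 0 (s≤s z≤n)))))))
    by-residue (suc (suc (suc _))) (s≤s (s≤s (s≤s ()))) _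

  Representative : ℕ → ℕ → ℕ → Set
  Representative a b c = Valid a b c × a < b × a < c

  valid-rotate : ∀ {a b c} → Valid a b c → Valid b c a
  valid-rotate {a} {b} {c} ((a<p , b<p , c<p) , (a≢b , b≢c , a≢c) , p∤S) =
    (b<p , c<p , a<p) , (b≢c , ≢-sym a≢c , ≢-sym a≢b) , λ p∣S′ → p∤S (subst (p ∣_) (S′≡S a b c) p∣S′)
    where
    S′≡S : ∀ a b c → b + c + a + 1 ≡ a + b + c + 1
    S′≡S = solve 3 (λ a b c → b :+ c :+ a :+ con 1 := a :+ b :+ c :+ con 1) refl

  representatives-rotated⇒≡ : ∀ {a b c a′ b′ c′} → Representative a b c → Representative a′ b′ c′ →
                              Rotated a b c a′ b′ c′ → (a′ , b′ , c′) ≡ (a , b , c)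
  representatives-rotated⇒≡ _ _ (inj₁ eq) = eq
  representatives-rotated⇒≡ (_ , a<b , _) (_ , _ , b<a) (inj₂ (inj₁ refl)) = ⊥-elim (<-asym a<b b<a)
  representatives-rotated⇒≡ (_ , _ , a<c) (_ , c<a , _) (inj₂ (inj₂ refl)) = ⊥-elim (<-asym a<c c<a)

  record RepresentativeOf (a b c : ℕ) : Set where
    field
      a′ b′ c′       : ℕ
      representative : Representative a′ b′ c′
      rotated        : Rotated a b c a′ b′ c′

  representativeOf : ∀ {a b c} → Valid a b c → RepresentativeOf a b c
  representativeOf {a} {b} {c} v@(_ , (a≢b , b≢c , a≢c) , _) = by-order (a <? b) (a <? c) (b <? c)
    where
    c-least : c < a → c < b → RepresentativeOf a b c
    c-least c<a c<b = record { representative = valid-rotate (valid-rotate v) , c<a , c<b ; rotated = inj₂ (inj₂ refl) }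
    by-order : Dec (a < b) → Dec (a < c) → Dec (b < c) → RepresentativeOf a b c
    by-order (yes a<b) (yes a<c) _ = record { representative = v , a<b , a<c ; rotated = inj₁ refl }
    by-order (yes a<b) (no a≮c)  _ = c-least c<a (<-trans c<a a<b)
      where c<a = ≤∧≢⇒< (≮⇒≥ a≮c) (≢-sym a≢c)
    by-order (no a≮b)  _ (yes b<c) = record { representative = valid-rotate v , b<c , b<a ; rotated = inj₂ (inj₁ refl) }
      where b<a = ≤∧≢⇒< (≮⇒≥ a≮b) (≢-sym a≢b)
    by-order (no a≮b)  _ (no b≮c)  = c-least (<-trans c<b b<a) c<b
      where
      b<a = ≤∧≢⇒< (≮⇒≥ a≮b) (≢-sym a≢b)
      c<b = ≤∧≢⇒< (≮⇒≥ b≮c) (≢-sym b≢c)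

  module CircularPolygon (P : Polygon n) (circular : Circular p P) where

    open ClassStepped (circular⇒ClassStepped P circular)

    e : ℕ → ℕ
    e k = steps k % n / 3

    3*e+1≈steps : ∀ k → k < 3 → 3 * e k + 1 ≈ steps k
    3*e+1≈steps k k<3 = ≈-trans (≡⇒≈ (sym (begin
      steps k % n                   ≡⟨ m≡m%n+[m/n]*n (steps k % n) 3 ⟩
      steps k % n % 3 + e k * 3     ≡⟨ cong (_+ e k * 3) residue≡1 ⟩
      1 + e k * 3                   ≡⟨ solve 1 (λ e → con 1 :+ e :* con 3 := con 3 :* e :+ con 1) refl (e k) ⟩
      3 * e k + 1                   ∎))) (m%n≈m (steps k))
      where
      open ≡-Reasoning
      residue≡1 : steps k % n % 3 ≡ 1
      residue≡1 = trans (Mod3.≈⇒%≡ (≈⇒≈₃ (m%n≈m (steps k)))) (ascending k k<3)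

    e<p : ∀ k → e k < p
    e<p k = m<n*o⇒m/o<n (subst (steps k % n <_) (*-comm 3 p) (m%n<n (steps k) n))

    steps≈stepsOf : ∀ k → k < 3 → steps k ≈ stepsOf (e 0) (e 1) (e 2) k
    steps≈stepsOf 0 k<3 = ≈-sym (3*e+1≈steps 0 k<3)
    steps≈stepsOf 1 k<3 = ≈-sym (3*e+1≈steps 1 k<3)
    steps≈stepsOf 2 k<3 = ≈-sym (3*e+1≈steps 2 k<3)
    steps≈stepsOf (suc (suc (suc _))) (s≤s (s≤s (s≤s ())))

    edges′ : ∀ {x y} → Edge n P x y ⇔ StepEdge (stepsOf (e 0) (e 1) (e 2)) x y
    edges′ = ⇔-trans edges (mk⇔ (StepEdge-cong steps≈stepsOf) (StepEdge-cong λ k k<3 → ≈-sym (steps≈stepsOf k k<3)))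

    axis : ∀ γ → (∀ k → k < 3 → steps k ≈ steps ((γ + 2 * k + 2) % 3)) → HasSymmetryAxis n P
    axis γ h = γ , mapsOnto P P edges edges (reflect n γ) (mk⇔ (StepEdge-reflect γ ascending h) back)
      where
      back : ∀ {x y} → StepEdge steps (reflect n γ x) (reflect n γ y) → StepEdge steps x y
      back {x} {y} edge =
        subst₂ (StepEdge steps) (reflect-involutive γ x) (reflect-involutive γ y) (StepEdge-reflect γ ascending h edge)

    e-≡⇒steps-≈ : ∀ {i j} → i < 3 → j < 3 → e i ≡ e j → steps i ≈ steps j
    e-≡⇒steps-≈ {i} {j} i<3 j<3 eq =
      ≈-trans (≈-sym (3*e+1≈steps i i<3)) (≈-trans (≡⇒≈ (cong (λ x → 3 * x + 1) eq)) (3*e+1≈steps j j<3))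

    -- equal steps out of two classes would make the polygon symmetric in the axis swapping them
    e₀≢e₁ : e 0 ≢ e 1
    e₀≢e₁ eq = proj₁ circular (axis 2 swap)
      where
      swap : ∀ k → k < 3 → steps k ≈ steps ((2 + 2 * k + 2) % 3)
      swap 0 _ = e-≡⇒steps-≈ (s≤s z≤n) (s≤s (s≤s z≤n)) eq
      swap 1 _ = e-≡⇒steps-≈ (s≤s (s≤s z≤n)) (s≤s z≤n) (sym eq)
      swap 2 _ = ≈-refl
      swap (suc (suc (suc _))) (s≤s (s≤s (s≤s ())))

    e₁≢e₂ : e 1 ≢ e 2
    e₁≢e₂ eq = proj₁ circular (axis 1 swap)
      where
      swap : ∀ k → k < 3 → steps k ≈ steps ((1 + 2 * k + 2) % 3)
      swap 0 _ = ≈-refl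
      swap 1 _ = e-≡⇒steps-≈ (s≤s (s≤s z≤n)) ≤-refl eq
      swap 2 _ = e-≡⇒steps-≈ ≤-refl (s≤s (s≤s z≤n)) (sym eq)
      swap (suc (suc (suc _))) (s≤s (s≤s (s≤s ())))

    e₀≢e₂ : e 0 ≢ e 2
    e₀≢e₂ eq = proj₁ circular (axis 0 swap)
      where
      swap : ∀ k → k < 3 → steps k ≈ steps ((0 + 2 * k + 2) % 3)
      swap 0 _ = e-≡⇒steps-≈ (s≤s z≤n) ≤-refl eq
      swap 1 _ = ≈-refl
      swap 2 _ = e-≡⇒steps-≈ ≤-refl (s≤s z≤n) (sym eq)
      swap (suc (suc (suc _))) (s≤s (s≤s (s≤s ())))

    p∤S : ¬ (p ∣ e 0 + e 1 + e 2 + 1)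
    p∤S (divides q S≡q*p) = total≉0 (begin
      steps 0 + steps 1 + steps 2
        ≈⟨ +-cong (+-cong (steps≈stepsOf 0 (s≤s z≤n)) (steps≈stepsOf 1 (s≤s (s≤s z≤n)))) (steps≈stepsOf 2 ≤-refl) ⟩
      3 * e 0 + 1 + (3 * e 1 + 1) + (3 * e 2 + 1)
        ≡⟨ solve 3 (λ a b c → con 3 :* a :+ con 1 :+ (con 3 :* b :+ con 1) :+ (con 3 :* c :+ con 1)
                              := con 3 :* (a :+ b :+ c :+ con 1)) refl (e 0) (e 1) (e 2) ⟩
      3 * (e 0 + e 1 + e 2 + 1)    ≡⟨ cong (3 *_) S≡q*p ⟩
      3 * (q * p)                  ≡⟨ solve 2 (λ q p → con 3 :* (q :* p) := q :* (con 3 :* p)) refl q p ⟩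
      q * n                        ≈⟨ m*n≈0 q ⟩
      0                            ∎)
      where open ≈-Reasoning

    valid : Valid (e 0) (e 1) (e 2)
    valid = (e<p 0 , e<p 1 , e<p 2) , (e₀≢e₁ , e₁≢e₂ , e₀≢e₂) , p∤S

  -- holds by refl: the vertex sequence of canonical a b c v does not depend on v
  equivalent-canonical-cong : ∀ {P a b c a′ b′ c′} → (a , b , c) ≡ (a′ , b′ , c′) → (v : Valid a b c) (v′ : Valid a′ b′ c′) →
                              Equivalent n P (canonical a b c v) → Equivalent n P (canonical a′ b′ c′ v′)
  equivalent-canonical-cong refl v v′ equivalent = equivalent

  record RepresentedBy (P : Polygon n) : Set where
    field
      a b c          : ℕ
      representative : Representative a b c
      equivalent     : Equivalent n P (canonical a b c (proj₁ representative))

  circular⇒representedBy : ∀ P → Circular p P → RepresentedBy P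
  circular⇒representedBy P circular = record
    { representative = representative
    ; equivalent     = equivalent-by-steps P (canonical a′ b′ c′ (proj₁ representative)) γ edges′
                         (canonical-edges a′ b′ c′ (proj₁ representative))
                         (λ k k<3 → ≡⇒≈ (same-steps k k<3))
    }
    where
    open CircularPolygon P circular
    open RepresentativeOf (representativeOf valid)
    γ = proj₁ (rotated-steps rotated)
    same-steps = proj₂ (rotated-steps rotated)

-- Counting the triples

module Counting (p : ℕ) .{{_ : NonZero p}} (p-prime : Prime p) (3<p : 3 < p) where

  open Classification p p-prime 3<p public

  valid? : ∀ a b c → Dec (Valid a b c)
  valid? a b c = ((a <? p) ×-dec (b <? p) ×-dec (c <? p))
           ×-dec (¬? (a ≟ b) ×-dec ¬? (b ≟ c) ×-dec ¬? (a ≟ c))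
           ×-dec ¬? (p ∣? a + b + c + 1)

  least? : ∀ a b c → Dec (a < b × a < c)
  least? a b c = (a <? b) ×-dec (a <? c)

  representative? : ∀ a b c → Dec (Representative a b c)
  representative? a b c = valid? a b c ×-dec least? a b c

  ∑³ : (ℕ → ℕ → ℕ → ℕ) → ℕ
  ∑³ F = ∑[ a < p ] ∑[ b < p ] ∑[ c < p ] F a b c

  ∑³-cong : ∀ {F G} → (∀ a b c → a < p → b < p → c < p → F a b c ≡ G a b c) → ∑³ F ≡ ∑³ G
  ∑³-cong F≡G = ∑-cong p λ a a<p → ∑-cong p λ b b<p → ∑-cong p λ c c<p → F≡G a b c a<p b<p c<p

  ∑³-distrib-+ : ∀ F G → ∑³ (λ a b c → F a b c + G a b c) ≡ ∑³ F + ∑³ G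
  ∑³-distrib-+ F G = trans (∑-cong p λ a _ → trans (∑-cong p λ b _ → ∑-distrib-+ p (F a b) (G a b)) (∑-distrib-+ p _ _))
                           (∑-distrib-+ p _ _)

  ∑³-rotate : ∀ F → ∑³ (λ a b c → F b c a) ≡ ∑³ F
  ∑³-rotate F = trans (∑-comm p p (λ a b → ∑[ c < p ] F b c a)) (∑-cong p λ b _ → ∑-comm p p (λ a c → F b c a))

  𝟙-valid-rotate : ∀ a b c → 𝟙[ valid? b c a ] ≡ 𝟙[ valid? a b c ]
  𝟙-valid-rotate a b c = 𝟙-cong (valid? b c a) (valid? a b c) (mk⇔ (λ v → valid-rotate (valid-rotate v)) valid-rotate)

  exactly-one-least : ∀ {a b c} → a ≢ b → b ≢ c → a ≢ c → 𝟙[ least? a b c ] + 𝟙[ least? b c a ] + 𝟙[ least? c a b ] ≡ 1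
  exactly-one-least {a} {b} {c} a≢b b≢c a≢c = by-order (a <? b) (a <? c) (b <? c)
    where
    b<a⇒ : ¬ a < b → b < a
    b<a⇒ a≮b = ≤∧≢⇒< (≮⇒≥ a≮b) (≢-sym a≢b)
    by-order : Dec (a < b) → Dec (a < c) → Dec (b < c) → 𝟙[ least? a b c ] + 𝟙[ least? b c a ] + 𝟙[ least? c a b ] ≡ 1
    by-order (yes a<b) (yes a<c) _ = cong₂ _+_ (cong₂ _+_ (𝟙-yes (least? a b c) (a<b , a<c))
      (𝟙-no (least? b c a) (λ l → <-asym a<b (proj₂ l)))) (𝟙-no (least? c a b) (λ l → <-asym a<c (proj₁ l)))
    by-order (yes a<b) (no a≮c) _ = cong₂ _+_ (cong₂ _+_ (𝟙-no (least? a b c) (λ l → a≮c (proj₂ l)))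
      (𝟙-no (least? b c a) (λ l → <-asym a<b (proj₂ l)))) (𝟙-yes (least? c a b) (c<a , <-trans c<a a<b))
      where c<a = ≤∧≢⇒< (≮⇒≥ a≮c) (≢-sym a≢c)
    by-order (no a≮b) _ (yes b<c) = cong₂ _+_ (cong₂ _+_ (𝟙-no (least? a b c) (λ l → a≮b (proj₁ l)))
      (𝟙-yes (least? b c a) (b<c , b<a⇒ a≮b))) (𝟙-no (least? c a b) (λ l → <-asym b<c (proj₂ l)))
    by-order (no a≮b) _ (no b≮c) = cong₂ _+_ (cong₂ _+_ (𝟙-no (least? a b c) (λ l → a≮b (proj₁ l)))
      (𝟙-no (least? b c a) (λ l → b≮c (proj₁ l)))) (𝟙-yes (least? c a b) (<-trans c<b (b<a⇒ a≮b) , c<b))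
      where c<b = ≤∧≢⇒< (≮⇒≥ b≮c) (≢-sym b≢c)

  rotations-representative : ∀ a b c → 𝟙[ representative? a b c ] + 𝟙[ representative? b c a ] + 𝟙[ representative? c a b ]
                                       ≡ 𝟙[ valid? a b c ]
  rotations-representative a b c = begin
    𝟙[ representative? a b c ] + 𝟙[ representative? b c a ] + 𝟙[ representative? c a b ]
      ≡⟨ cong₂ _+_ (cong₂ _+_ (𝟙-× (valid? a b c) (least? a b c)) (𝟙-× (valid? b c a) (least? b c a)))
                   (𝟙-× (valid? c a b) (least? c a b)) ⟩
    V₁ * L₁ + 𝟙[ valid? b c a ] * L₂ + 𝟙[ valid? c a b ] * L₃
      ≡⟨ cong₂ (λ u v → V₁ * L₁ + u * L₂ + v * L₃) (𝟙-valid-rotate a b c) (trans (𝟙-valid-rotate b c a) (𝟙-valid-rotate a b c)) ⟩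
    V₁ * L₁ + V₁ * L₂ + V₁ * L₃
      ≡⟨ solve 4 (λ v x y z → v :* x :+ v :* y :+ v :* z := v :* (x :+ y :+ z)) refl V₁ L₁ L₂ L₃ ⟩
    V₁ * (L₁ + L₂ + L₃)
      ≡⟨ by-validity (valid? a b c) ⟩
    V₁ ∎
    where
    open ≡-Reasoning
    V₁ = 𝟙[ valid? a b c ]
    L₁ = 𝟙[ least? a b c ]
    L₂ = 𝟙[ least? b c a ]
    L₃ = 𝟙[ least? c a b ]
    by-validity : (v : Dec (Valid a b c)) → 𝟙[ v ] * (L₁ + L₂ + L₃) ≡ 𝟙[ v ]
    by-validity (yes (_ , (a≢b , b≢c , a≢c) , _)) = trans (+-identityʳ _) (exactly-one-least a≢b b≢c a≢c)
    by-validity (no _) = refl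

  valid≡3*representatives : ∑³ (λ a b c → 𝟙[ valid? a b c ]) ≡ 3 * ∑³ (λ a b c → 𝟙[ representative? a b c ])
  valid≡3*representatives = begin
    ∑³ V                                                       ≡⟨ ∑³-cong (λ a b c _ _ _ → sym (rotations-representative a b c)) ⟩
    ∑³ (λ a b c → R a b c + R b c a + R c a b)                 ≡⟨ ∑³-distrib-+ (λ a b c → R a b c + R b c a) (λ a b c → R c a b) ⟩
    ∑³ (λ a b c → R a b c + R b c a) + ∑³ (λ a b c → R c a b)
      ≡⟨ cong₂ _+_ (∑³-distrib-+ R (λ a b c → R b c a)) (trans (∑³-rotate (λ a b c → R b c a)) (∑³-rotate R)) ⟩
    ∑³ R + ∑³ (λ a b c → R b c a) + ∑³ R                       ≡⟨ cong (λ x → ∑³ R + x + ∑³ R) (∑³-rotate R) ⟩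
    ∑³ R + ∑³ R + ∑³ R                                         ≡⟨ solve 1 (λ x → x :+ x :+ x := con 3 :* x) refl (∑³ R) ⟩
    3 * ∑³ R                                                   ∎
    where
    open ≡-Reasoning
    V R : ℕ → ℕ → ℕ → ℕ
    V a b c = 𝟙[ valid? a b c ]
    R a b c = 𝟙[ representative? a b c ]

  A? : ∀ g₁ g₂ → Dec (g₁ ≢ 0 × g₂ ≢ 0 × g₂ ≢ g₁)
  A? g₁ g₂ = ¬? (g₁ ≟ 0) ×-dec ¬? (g₂ ≟ 0) ×-dec ¬? (g₂ ≟ g₁)

  B? : ∀ a g₁ g₂ → Dec (¬ (p ∣ 3 * a + (g₁ + g₂ + 1)))
  B? a g₁ g₂ = ¬? (p ∣? 3 * a + (g₁ + g₂ + 1))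

  shift-injective : ∀ {a g h} → g < p → h < p → (a + g) % p ≡ (a + h) % p → g ≡ h
  shift-injective {a} g<p h<p eq = Mod-p.≈⇒≡ g<p h<p (Mod-p.+-cancelˡ-≈ a (Mod-p.mk≈ eq))

  shift-0 : ∀ {a} → a < p → (a + 0) % p ≡ a
  shift-0 {a} a<p = trans (cong (_% p) (+-identityʳ a)) (m<n⇒m%n≡m a<p)

  ∣-respects-≈ : ∀ {x y} → x Mod-p.≈ y → p ∣ x → p ∣ y
  ∣-respects-≈ x≈y p∣x = Mod-p.≈0⇒∣ (Mod-p.≈-trans (Mod-p.≈-sym x≈y) (Mod-p.∣⇒≈0 p∣x))

  -- writing b ≡ a + g₁ and c ≡ a + g₂ (mod p) separates the condition on a from those on g₁, g₂
  valid-shifted : ∀ {a g₁ g₂} → a < p → g₁ < p → g₂ < p →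
                  Valid a ((a + g₁) % p) ((a + g₂) % p) ⇔ ((g₁ ≢ 0 × g₂ ≢ 0 × g₂ ≢ g₁) × ¬ (p ∣ 3 * a + (g₁ + g₂ + 1)))
  valid-shifted {a} {g₁} {g₂} a<p g₁<p g₂<p = mk⇔ to from
    where
    sum≈ : a + (a + g₁) % p + (a + g₂) % p + 1 Mod-p.≈ 3 * a + (g₁ + g₂ + 1)
    sum≈ = Mod-p.≈-trans (Mod-p.+-congʳ 1 (Mod-p.+-cong (Mod-p.+-congˡ a (Mod-p.m%n≈m (a + g₁))) (Mod-p.m%n≈m (a + g₂))))
             (Mod-p.≡⇒≈ (solve 3 (λ a x y → a :+ (a :+ x) :+ (a :+ y) :+ con 1 := con 3 :* a :+ (x :+ y :+ con 1)) refl a g₁ g₂))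
    to : Valid a ((a + g₁) % p) ((a + g₂) % p) → _
    to (_ , (a≢b , b≢c , a≢c) , p∤S) =
      ( (λ g₁≡0 → a≢b (sym (trans (cong (λ g → (a + g) % p) g₁≡0) (shift-0 a<p))))
      , (λ g₂≡0 → a≢c (sym (trans (cong (λ g → (a + g) % p) g₂≡0) (shift-0 a<p))))
      , (λ g₂≡g₁ → b≢c (cong (λ g → (a + g) % p) (sym g₂≡g₁))) )
      , λ p∣ → p∤S (∣-respects-≈ (Mod-p.≈-sym sum≈) p∣)
    from : ((g₁ ≢ 0 × g₂ ≢ 0 × g₂ ≢ g₁) × ¬ (p ∣ 3 * a + (g₁ + g₂ + 1))) → Valid a ((a + g₁) % p) ((a + g₂) % p)
    from ((g₁≢0 , g₂≢0 , g₂≢g₁) , p∤) =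
      (a<p , m%n<n (a + g₁) p , m%n<n (a + g₂) p)
      , ( (λ a≡b → g₁≢0 (sym (shift-injective 0<p g₁<p (trans (shift-0 a<p) a≡b))))
        , (λ b≡c → g₂≢g₁ (sym (shift-injective g₁<p g₂<p b≡c)))
        , (λ a≡c → g₂≢0 (sym (shift-injective 0<p g₂<p (trans (shift-0 a<p) a≡c)))) )
      , λ p∣S → p∤ (∣-respects-≈ sum≈ p∣S)

  count-non-roots : ∀ c → ∑[ a < p ] 𝟙[ ¬? (p ∣? 3 * a + c) ] ≡ p ∸ 1
  count-non-roots c = from-root (Mod-p.affine-root c p∤3)
    where
    p∤3 : ¬ (p ∣ 3)
    p∤3 p∣3 = <⇒≱ 3<p (∣⇒≤ p∣3)
    from-root : Mod-p.UniqueRoot 3 c → ∑[ a < p ] 𝟙[ ¬? (p ∣? 3 * a + c) ] ≡ p ∸ 1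
    from-root (r , r<p , root , unique) = trans (∑-cong p λ a a<p → 𝟙-cong _ _ (mk⇔
        (λ p∤ a≡r → p∤ (subst (λ x → p ∣ 3 * x + c) (sym a≡r) (Mod-p.≈0⇒∣ root)))
        (λ a≢r p∣ → a≢r (unique a a<p (Mod-p.∣⇒≈0 p∣)))))
      (count-≢ p r<p)

  count-A : ∑[ g₁ < p ] ∑[ g₂ < p ] 𝟙[ A? g₁ g₂ ] ≡ (p ∸ 1) * (p ∸ 2)
  count-A = begin
    ∑[ g₁ < p ] ∑[ g₂ < p ] 𝟙[ A? g₁ g₂ ]
      ≡⟨ ∑-cong p (λ g₁ _ → trans (∑-cong p λ g₂ _ → 𝟙-× (¬? (g₁ ≟ 0)) _)
                                     (*-distribˡ-∑ p 𝟙[ ¬? (g₁ ≟ 0) ] λ g₂ → 𝟙[ ¬? (g₂ ≟ 0) ×-dec ¬? (g₂ ≟ g₁) ])) ⟩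
    ∑[ g₁ < p ] (𝟙[ ¬? (g₁ ≟ 0) ] * ∑[ g₂ < p ] 𝟙[ ¬? (g₂ ≟ 0) ×-dec ¬? (g₂ ≟ g₁) ])
      ≡⟨ ∑-cong p (λ g₁ g₁<p → 𝟙-*-cong (¬? (g₁ ≟ 0)) λ g₁≢0 → count-≢₂ p 0<p g₁<p (≢-sym g₁≢0)) ⟩
    ∑[ g₁ < p ] (𝟙[ ¬? (g₁ ≟ 0) ] * (p ∸ 2))
      ≡⟨ *-distribʳ-∑ p (p ∸ 2) _ ⟩
    (∑[ g₁ < p ] 𝟙[ ¬? (g₁ ≟ 0) ]) * (p ∸ 2)
      ≡⟨ cong (_* (p ∸ 2)) (count-≢ p 0<p) ⟩
    (p ∸ 1) * (p ∸ 2) ∎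
    where open ≡-Reasoning

  count-valid : ∑³ (λ a b c → 𝟙[ valid? a b c ]) ≡ (p ∸ 1) * ((p ∸ 1) * (p ∸ 2))
  count-valid = begin
    ∑³ (λ a b c → 𝟙[ valid? a b c ])
      ≡⟨ ∑-cong p (λ a a<p → shifted a a<p) ⟩
    ∑[ a < p ] ∑[ g₁ < p ] ∑[ g₂ < p ] (𝟙[ A? g₁ g₂ ] * 𝟙[ B? a g₁ g₂ ])
      ≡⟨ ∑-comm p p _ ⟩
    ∑[ g₁ < p ] ∑[ a < p ] ∑[ g₂ < p ] (𝟙[ A? g₁ g₂ ] * 𝟙[ B? a g₁ g₂ ])
      ≡⟨ ∑-cong p (λ g₁ _ → ∑-comm p p _) ⟩
    ∑[ g₁ < p ] ∑[ g₂ < p ] ∑[ a < p ] (𝟙[ A? g₁ g₂ ] * 𝟙[ B? a g₁ g₂ ])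
      ≡⟨ ∑-cong p (λ g₁ _ → ∑-cong p λ g₂ _ → trans (*-distribˡ-∑ p 𝟙[ A? g₁ g₂ ] λ a → 𝟙[ B? a g₁ g₂ ])
                                                    (cong (𝟙[ A? g₁ g₂ ] *_) (count-non-roots (g₁ + g₂ + 1)))) ⟩
    ∑[ g₁ < p ] ∑[ g₂ < p ] (𝟙[ A? g₁ g₂ ] * (p ∸ 1))
      ≡⟨ ∑-cong p (λ g₁ _ → *-distribʳ-∑ p (p ∸ 1) _) ⟩
    ∑[ g₁ < p ] ((∑[ g₂ < p ] 𝟙[ A? g₁ g₂ ]) * (p ∸ 1))
      ≡⟨ *-distribʳ-∑ p (p ∸ 1) _ ⟩
    (∑[ g₁ < p ] ∑[ g₂ < p ] 𝟙[ A? g₁ g₂ ]) * (p ∸ 1)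
      ≡⟨ cong (_* (p ∸ 1)) count-A ⟩
    (p ∸ 1) * (p ∸ 2) * (p ∸ 1)
      ≡⟨ *-comm ((p ∸ 1) * (p ∸ 2)) (p ∸ 1) ⟩
    (p ∸ 1) * ((p ∸ 1) * (p ∸ 2)) ∎
    where
    open ≡-Reasoning
    shifted : ∀ a → a < p →
              ∑[ b < p ] ∑[ c < p ] 𝟙[ valid? a b c ] ≡ ∑[ g₁ < p ] ∑[ g₂ < p ] (𝟙[ A? g₁ g₂ ] * 𝟙[ B? a g₁ g₂ ])
    shifted a a<p = begin
      ∑[ b < p ] ∑[ c < p ] 𝟙[ valid? a b c ]
        ≡⟨ ∑-cong p (λ b _ → ∑-rotate p a a<p (λ c → 𝟙[ valid? a b c ])) ⟨
      ∑[ b < p ] ∑[ g₂ < p ] 𝟙[ valid? a b ((a + g₂) % p) ]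
        ≡⟨ ∑-rotate p a a<p (λ b → ∑[ g₂ < p ] 𝟙[ valid? a b ((a + g₂) % p) ]) ⟨
      ∑[ g₁ < p ] ∑[ g₂ < p ] 𝟙[ valid? a ((a + g₁) % p) ((a + g₂) % p) ]
        ≡⟨ ∑-cong p (λ g₁ g₁<p → ∑-cong p λ g₂ g₂<p →
             trans (𝟙-cong _ (A? g₁ g₂ ×-dec B? a g₁ g₂) (valid-shifted a<p g₁<p g₂<p)) (𝟙-× (A? g₁ g₂) (B? a g₁ g₂))) ⟩
      ∑[ g₁ < p ] ∑[ g₂ < p ] (𝟙[ A? g₁ g₂ ] * 𝟙[ B? a g₁ g₂ ]) ∎

  count-representatives : ((p ∸ 1) ^ 2 * (p ∸ 2)) / 3 ≡ ∑³ (λ a b c → 𝟙[ representative? a b c ])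
  count-representatives = trans (cong (_/ 3) three-times) (m*n/n≡m (∑³ (λ a b c → 𝟙[ representative? a b c ])) 3)
    where
    three-times : (p ∸ 1) ^ 2 * (p ∸ 2) ≡ ∑³ (λ a b c → 𝟙[ representative? a b c ]) * 3
    three-times = trans (solve 2 (λ x y → x :* (x :* con 1) :* y := x :* (x :* y)) refl (p ∸ 1) (p ∸ 2))
                   (trans (sym count-valid) (trans valid≡3*representatives (*-comm 3 (∑³ (λ a b c → 𝟙[ representative? a b c ])))))

-- The list of classes

module Enumeration (p : ℕ) .{{_ : NonZero p}} (p-prime : Prime p) (3<p : 3 < p) where

  open Counting p p-prime 3<p public

  digit₀ digit₁ digit₂ : ℕ → ℕ
  digit₀ k = k / p / p
  digit₁ k = k / p % p
  digit₂ k = k % p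

  digits : ℕ → ℕ × ℕ × ℕ
  digits k = digit₀ k , digit₁ k , digit₂ k

  encode : ℕ → ℕ → ℕ → ℕ
  encode a b c = c + (b + a * p) * p

  [j+i*p]/p≡i : ∀ {j} i → j < p → (j + i * p) / p ≡ i
  [j+i*p]/p≡i {j} i j<p = trans (+-distrib-/-∣ʳ j (divides i refl)) (cong₂ _+_ (m<n⇒m/n≡0 j<p) (m*n/n≡m i p))

  [j+i*p]%p≡j : ∀ {j} i → j < p → (j + i * p) % p ≡ j
  [j+i*p]%p≡j {j} i j<p = trans ([m+kn]%n≡m%n j i p) (m<n⇒m%n≡m j<p)

  digits-encode : ∀ {a b c} → a < p → b < p → c < p → digits (encode a b c) ≡ (a , b , c)
  digits-encode {a} {b} {c} a<p b<p c<p = cong₂ _,_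
    (trans (cong (_/ p) ([j+i*p]/p≡i (b + a * p) c<p)) ([j+i*p]/p≡i a b<p))
    (cong₂ _,_ (trans (cong (_% p) ([j+i*p]/p≡i (b + a * p) c<p)) ([j+i*p]%p≡j a b<p)) ([j+i*p]%p≡j (b + a * p) c<p))

  digits-injective : ∀ {k k′} → digits k ≡ digits k′ → k ≡ k′
  digits-injective {k} {k′} eq = begin
    k                                       ≡⟨ m≡m%n+[m/n]*n k p ⟩
    k % p + k / p * p                       ≡⟨ cong (λ q → k % p + q * p) (m≡m%n+[m/n]*n (k / p) p) ⟩
    digit₂ k + (digit₁ k + digit₀ k * p) * p ≡⟨ cong (λ (x , y , z) → z + (y + x * p) * p) eq ⟩
    digit₂ k′ + (digit₁ k′ + digit₀ k′ * p) * p ≡⟨ cong (λ q → k′ % p + q * p) (m≡m%n+[m/n]*n (k′ / p) p) ⟨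
    k′ % p + k′ / p * p                     ≡⟨ m≡m%n+[m/n]*n k′ p ⟨
    k′                                      ∎
    where open ≡-Reasoning

  encode< : ∀ {a b c} → a < p → b < p → c < p → encode a b c < p * p * p
  encode< {a} {b} {c} a<p b<p c<p = digit-bound c<p (digit-bound b<p a<p)
    where
    digit-bound : ∀ {x y M} → x < p → y < M → x + y * p < M * p
    digit-bound {x} {y} x<p y<M = ≤-trans (+-monoˡ-< (y * p) x<p) (*-monoˡ-≤ p y<M)

  ∑-digits : ∀ F → ∑[ k < p * p * p ] F (digit₀ k) (digit₁ k) (digit₂ k) ≡ ∑³ F
  ∑-digits F = begin
    ∑[ k < p * p * p ] F (digit₀ k) (digit₁ k) (digit₂ k)
      ≡⟨ ∑-* (p * p) p _ ⟩
    ∑[ i < p * p ] ∑[ j < p ] F ((j + i * p) / p / p) ((j + i * p) / p % p) ((j + i * p) % p)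
      ≡⟨ ∑-cong (p * p) (λ i _ → ∑-cong p λ j j<p →
           cong₂ (λ x z → F (x / p) (x % p) z) ([j+i*p]/p≡i i j<p) ([j+i*p]%p≡j i j<p)) ⟩
    ∑[ i < p * p ] ∑[ j < p ] F (i / p) (i % p) j
      ≡⟨ ∑-* p p _ ⟩
    ∑[ a < p ] ∑[ b < p ] ∑[ j < p ] F ((b + a * p) / p) ((b + a * p) % p) j
      ≡⟨ ∑-cong p (λ a _ → ∑-cong p λ b b<p → ∑-cong p λ j _ →
           cong₂ (λ x y → F x y j) ([j+i*p]/p≡i a b<p) ([j+i*p]%p≡j a b<p)) ⟩
    ∑³ F ∎
    where open ≡-Reasoning

  RepresentativeCode : ℕ → Set
  RepresentativeCode k = Representative (digit₀ k) (digit₁ k) (digit₂ k)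

  open Satisfiers (λ k → representative? (digit₀ k) (digit₁ k) (digit₂ k))

  codes : List (Σ ℕ RepresentativeCode)
  codes = satisfiers (p * p * p)

  polygonOfCode : Σ ℕ RepresentativeCode → Polygon n
  polygonOfCode (k , r) = canonical (digit₀ k) (digit₁ k) (digit₂ k) (proj₁ r)

  classes : List (Polygon n)
  classes = map polygonOfCode codes

  length-classes : length classes ≡ ((p ∸ 1) ^ 2 * (p ∸ 2)) / 3
  length-classes = begin
    length classes
      ≡⟨ length-map polygonOfCode codes ⟩
    length codes
      ≡⟨ length-satisfiers (p * p * p) ⟩
    ∑[ k < p * p * p ] 𝟙[ representative? (digit₀ k) (digit₁ k) (digit₂ k) ]
      ≡⟨ ∑-digits (λ a b c → 𝟙[ representative? a b c ]) ⟩
    ∑³ (λ a b c → 𝟙[ representative? a b c ])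
      ≡⟨ count-representatives ⟨
    ((p ∸ 1) ^ 2 * (p ∸ 2)) / 3 ∎
    where open ≡-Reasoning

  classes-circular : All (Circular p) classes
  classes-circular = Allₚ.map⁺ (All.universal (λ (k , r) → canonical-circular _ _ _ (proj₁ r)) codes)

  classes-inequivalent : AllPairs (λ P Q → ¬ Equivalent n P Q) classes
  classes-inequivalent = AllPairsₚ.map⁺ {f = polygonOfCode} codes-inequivalent
    where
    inequivalent : (λ x y → proj₁ y < proj₁ x) ⇒ (λ x y → ¬ Equivalent n (polygonOfCode x) (polygonOfCode y))
    inequivalent {k , r} {k′ , r′} k′<k equivalent =
      <⇒≢ k′<k (digits-injective (representatives-rotated⇒≡ r r′ (equivalent⇒rotated (proj₁ r) (proj₁ r′) equivalent)))
    codes-inequivalent : AllPairs (λ x y → ¬ Equivalent n (polygonOfCode x) (polygonOfCode y)) codes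
    codes-inequivalent = AllPairs.map (λ {x} {y} → inequivalent {x} {y}) (satisfiers-decreasing (p * p * p))

  classes-complete : ∀ P → Circular p P → Any (λ Q → Equivalent n P Q) classes
  classes-complete P circular = Anyₚ.map⁺ {f = polygonOfCode} (Any.map (λ {x} → equivalent-at {x})
                                  (satisfiers-complete (p * p * p) (encode< a<p b<p c<p) coded))
    where
    open RepresentedBy (circular⇒representedBy P circular)
    a<p = proj₁ (proj₁ (proj₁ representative))
    b<p = proj₁ (proj₂ (proj₁ (proj₁ representative)))
    c<p = proj₂ (proj₂ (proj₁ (proj₁ representative)))
    coded : RepresentativeCode (encode a b c)
    coded = subst (λ (x , y , z) → Representative x y z) (sym (digits-encode a<p b<p c<p)) representative
    equivalent-at : (λ x → proj₁ x ≡ encode a b c) ⊆ (λ x → Equivalent n P (polygonOfCode x))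
    equivalent-at {k , r} refl =
      equivalent-canonical-cong {P} (sym (digits-encode a<p b<p c<p)) (proj₁ representative) (proj₁ r) equivalent

mainTheorem6 : (p : ℕ) .{{_ : NonZero p}} → Prime p → 3 < p →
    NumCircularClasses p (((p ∸ 1) ^ 2 * (p ∸ 2)) / 3)
mainTheorem6 p p-prime 3<p = classes , length-classes , classes-circular , classes-inequivalent , classes-complete
  where open Enumeration p p-prime 3<p
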